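{- For every $k\geq 1$, the following identities of formal power series hold: $$D_k(t)=\frac{X_2(t)}{t}\,F_k\big(X_2(t),t\big),\qquad F_k(x,t)=t\,\frac{\partial B_{k-1}(x,t)}{\partial t}+(1-k)B_{k-1}(x,t),$$ $$\Big(1-x-\frac{t}{x}\Big)B_k(x,t)=F_k(x,t)-\frac{t}{x}D_k(t).$$ With the convention $F_0(x,t):=1$, the last identity also holds for $k=0$. Moreover $D_0(t)=C(t)=\frac{1-\sqrt{1-4t}}{2t}$.
   Context: Rows are numbered from the bottom. $b_{n,m,k}$ (for $n\geq m\geq k\geq 0$): for a $k$-subset $S\subseteq\{1,\dots,m\}$, take the cells $(1,j)$ for $j\leq n$, $(2,j)$ for $j\leq m$, and $(3,j)$ for $j\in S$. Count bijective fillings $T$ with $\{1,\dots,n+m+k\}$ such that: - rows 1 and 2 increase left to right; - $T(1,j)<T(2,j)$ for $j\leq m$, and $T(2,j)<T(3,j)$ for $j\in S$. $b_{n,m,k}$ is the sum of these counts over all $S$. $b_{n,k}$: for a $k$-subset $S\subseteq\{1,\dots,n\}$, take the cells $(3,j),(2,j)$ for $j\leq n$ and $(1,j)$ for $j\in S$. Count bijective fillings with $\{1,\dots,2n+k\}$ such that: - rows 2 and 3 increase left to right; - $T(2,j)<T(3,j)$ for all $j$, and $T(1,j)<T(2,j)$ for $j\in S$. $b_{n,k}$ is the sum of these counts over all $S$. Generating functions: - $D_k(t)=\sum_{n\geq 0}b_{n,k}t^n$, with $b_{n,k}=0$ for $n<k$; - $B_k(x,t)=\sum_{k\leq m\leq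 n}b_{n,m,k}x^{n-m}t^m$; - for $k\geq 1$, $F_k(x,t)=\sum_{k\leq m\leq n}(m-k+1)b_{n,m,k-1}x^{n-m}t^m$; - $X_2(t)=\frac{1-\sqrt{1-4t}}{2}$, a power series in $t$ with zero constant term. -}

module Defs where

open import Data.Bool using (Bool; true; false; if_then_else_; _∧_)
open import Data.Nat as ℕ using (ℕ; zero; suc; _≡ᵇ_; _<ᵇ_; _≤ᵇ_; _∸_)
open import Data.Integer as ℤ using (ℤ; +_; _+_; _-_; _*_)
open import Data.List using (List; []; _∷_; _++_; map; concatMap; applyUpTo; zip; length; filterᵇ)
open import Data.Product using (_×_; _,_)

range1 : ℕ → List ℕ
range1 n = applyUpTo suc n

choose : List ℕ → ℕ → List (List ℕ)
choose xs zero = [] ∷ []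
choose [] (suc k) = []
choose (x ∷ xs) (suc k) = map (x ∷_) (choose xs k) ++ choose xs (suc k)

insertEverywhere : ℕ → List ℕ → List (List ℕ)
insertEverywhere x [] = (x ∷ []) ∷ []
insertEverywhere x (y ∷ ys) = (x ∷ y ∷ ys) ∷ map (y ∷_) (insertEverywhere x ys)

perms : List ℕ → List (List ℕ)
perms [] = [] ∷ []
perms (x ∷ xs) = concatMap (insertEverywhere x) (perms xs)

-- a cell is (row , column); rows numbered from the bottom
Cell : Set
Cell = ℕ × ℕ

Filling : Set
Filling = List (Cell × ℕ)

fillings : List Cell → List Filling
fillings cells = map (zip cells) (perms (range1 (length cells)))

-- value of a filling at a cell (0 if absent; never used on absent cells)
val : Filling → Cell → ℕ
val [] c = 0
val (((r , j) , v) ∷ rest) (r' , j') =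
  if (r ≡ᵇ r') ∧ (j ≡ᵇ j') then v else val rest (r' , j')

allB : {A : Set} → (A → Bool) → List A → Bool
allB p [] = true
allB p (x ∷ xs) = p x ∧ allB p xs

rowIncr : Filling → ℕ → ℕ → Bool
rowIncr T r len = allB (λ j → val T (r , j) <ᵇ val T (r , suc j)) (range1 (len ∸ 1))

colLess : Filling → ℕ → ℕ → List ℕ → Bool
colLess T r r' js = allB (λ j → val T (r , j) <ᵇ val T (r' , j)) js

count : {A : Set} → (A → Bool) → List A → ℕ
count p xs = length (filterᵇ p xs)

sumℕ : List ℕ → ℕ
sumℕ [] = 0
sumℕ (x ∷ xs) = x ℕ.+ sumℕ xs

shapeB3 : ℕ → ℕ → List ℕ → List Cell
shapeB3 n m S = map (1 ,_) (range1 n) ++ map (2 ,_) (range1 m) ++ map (3 ,_) S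

validB3 : ℕ → ℕ → List ℕ → Filling → Bool
validB3 n m S T = rowIncr T 1 n ∧ rowIncr T 2 m ∧ colLess T 1 2 (range1 m) ∧ colLess T 2 3 S

bnmk : ℕ → ℕ → ℕ → ℕ
bnmk n m k = sumℕ (map (λ S → count (validB3 n m S) (fillings (shapeB3 n m S))) (choose (range1 m) k))

shapeB2 : ℕ → List ℕ → List Cell
shapeB2 n S = map (3 ,_) (range1 n) ++ map (2 ,_) (range1 n) ++ map (1 ,_) S

validB2 : ℕ → List ℕ → Filling → Bool
validB2 n S T = rowIncr T 2 n ∧ rowIncr T 3 n ∧ colLess T 2 3 (range1 n) ∧ colLess T 1 2 S

bnk : ℕ → ℕ → ℕ
bnk n k = sumℕ (map (λ S → count (validB2 n S) (fillings (shapeB2 n S))) (choose (range1 n) k))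

Ser : Set
Ser = ℕ → ℤ

-- bivariate series in x,t: f i j = coefficient of x^i t^j
Ser2 : Set
Ser2 = ℕ → ℕ → ℤ

sumTo : ℕ → (ℕ → ℤ) → ℤ
sumTo zero f = f 0
sumTo (suc N) f = sumTo N f + f (suc N)

oneS : Ser
oneS zero = + 1
oneS (suc n) = + 0

_⋆_ : Ser → Ser → Ser
(f ⋆ g) N = sumTo N (λ i → f i * g (N ∸ i))

_⊟_ : Ser → Ser → Ser
(f ⊟ g) n = f n - g n

powS : Ser → ℕ → Ser
powS X zero = oneS
powS X (suc a) = X ⋆ powS X a

oneMinus4t : Ser
oneMinus4t zero = + 1
oneMinus4t (suc zero) = ℤ.- (+ 4)
oneMinus4t (suc (suc n)) = + 0

mulTS : Ser → Ser
mulTS f zero = + 0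
mulTS f (suc n) = f n

-- substitution F(X(t), t) for X with zero constant term:
-- [t^N] = Σ_{m ≤ N} Σ_{a ≤ N} F_{a,m} [t^{N-m}] X^a
substX : Ser2 → Ser → Ser
substX F X N = sumTo N (λ m → sumTo N (λ a → F a m * powS X a (N ∸ m)))

mulX : Ser2 → Ser2
mulX f zero j = + 0
mulX f (suc i) j = f i j

mulT : Ser2 → Ser2
mulT f i zero = + 0
mulT f i (suc j) = f i j

_⊟₂_ : Ser2 → Ser2 → Ser2
(f ⊟₂ g) i j = f i j - g i j

constX : Ser → Ser2
constX D zero j = D j
constX D (suc i) j = + 0

tDt : Ser2 → Ser2
tDt f i j = + j * f i j

D : ℕ → Ser
D k n = + bnk n k

-- B_k(x,t) = Σ_{k ≤ m ≤ n} b_{n,m,k} x^{n-m} t^m ;  [x^i t^j] = b_{i+j, j, k} if k ≤ j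
B : ℕ → Ser2
B k i j = if k ≤ᵇ j then + bnmk (i ℕ.+ j) j k else + 0

-- F_k(x,t) = Σ_{k ≤ m ≤ n} (m-k+1) b_{n,m,k-1} x^{n-m} t^m for k ≥ 1,
-- with the convention F_0 := 1
F : ℕ → Ser2
F zero zero zero = + 1
F zero zero (suc j) = + 0
F zero (suc i) j = + 0
F (suc k) i j = if suc k ≤ᵇ j then + ((j ∸ k) ℕ.* bnmk (i ℕ.+ j) j k) else + 0

-- Remove the largest entry of a b_{n,m,k} filling: it sits at the end of row 1 (possible only if
-- m < n), at the end of row 2 (only if column m has no row-3 cell) or at one of the k row-3 cells,
-- so b_{n+1,m,k} = [m ≤ n] b_{n,m,k} + b_{n+1,m-1,k} + (m-k+1) b_{n+1,m,k-1}.  In generating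
-- functions this is (x - x² - t) B_k = x F_k - t B_k(0,t), and rotating a b_{n,k} filling by 180°
-- while complementing its entries shows b_{n,n,k} = b_{n,k}, i.e. B_k(0,t) = D_k.  The power series
-- X₂ = (1 - √(1-4t))/2 satisfies X₂ - X₂² = t, so substituting x := X₂ annihilates the left side and
-- leaves t D_k = X₂ F_k(X₂,t); for k = 0, F_0 = 1 gives t D_0 = X₂.  The formula for F_k is the
-- coefficientwise identity m - k + 1 = m + (1 - k).

module Submission where

open import Defs

module Tableaux where

  open import Data.Bool using (Bool; true; false; if_then_else_; _∧_; _∨_; T)
  open import Data.Bool.Properties using (∧-zeroʳ; ∧-identityʳ; ∧-assoc; ∧-comm; ∨-comm; ∨-assoc)
  open import Data.Empty using (⊥; ⊥-elim)
  open import Data.List using (List; []; _∷_; _++_; map; concatMap; applyUpTo; zip; length; reverse; _∷ʳ_)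
  open import Data.List.Properties
    using (concatMap-cong; map-++; map-∘; map-applyUpTo; applyUpTo-∷ʳ; length-applyUpTo; length-map;
           length-reverse; ++-identityʳ; unfold-reverse; reverse-++)
  open import Data.List.Relation.Unary.All as All using (All; []; _∷_)
  open import Data.List.Relation.Unary.All.Properties using (map⁺; ++⁺; concat⁺; applyUpTo⁺₂)
  import Data.List.Relation.Binary.Permutation.Propositional as ↭
  open ↭ using (_↭_)
  import Data.List.Relation.Binary.Permutation.Propositional.Properties as ↭ₚ
  open import Data.Nat using (ℕ; zero; suc; _+_; _*_; _∸_; _≤_; _<_; z≤n; s≤s; _≡ᵇ_; _<ᵇ_; _≤ᵇ_)
  open import Data.Nat.Properties
  open import Data.Nat.Tactic.RingSolver using (solve-∀)
  open import Data.Product using (_×_; _,_; proj₁; proj₂)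
  open import Data.Sum using (_⊎_; inj₁; inj₂)
  open import Data.Unit using (⊤; tt)
  open import Function using (_∘_)
  open import Relation.Nullary using (¬_)
  open import Relation.Binary.PropositionalEquality

  variable
    A A′ : Set

  +-interchange : ∀ a b c d → a + b + (c + d) ≡ a + c + (b + d)
  +-interchange = solve-∀

  sumBy : (A → ℕ) → List A → ℕ
  sumBy f [] = 0
  sumBy f (x ∷ xs) = f x + sumBy f xs

  sumBy-++ : (f : A → ℕ) (xs ys : List A) → sumBy f (xs ++ ys) ≡ sumBy f xs + sumBy f ys
  sumBy-++ f [] ys = refl
  sumBy-++ f (x ∷ xs) ys = trans (cong (f x +_) (sumBy-++ f xs ys)) (sym (+-assoc (f x) (sumBy f xs) (sumBy f ys)))

  sumBy-∷ʳ : (f : A → ℕ) (xs : List A) (y : A) → sumBy f (xs ∷ʳ y) ≡ sumBy f xs + f y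
  sumBy-∷ʳ f xs y = trans (sumBy-++ f xs (y ∷ [])) (cong (sumBy f xs +_) (+-identityʳ (f y)))

  sumBy-map : (f : A′ → ℕ) (g : A → A′) (xs : List A) → sumBy f (map g xs) ≡ sumBy (f ∘ g) xs
  sumBy-map f g [] = refl
  sumBy-map f g (x ∷ xs) = cong (f (g x) +_) (sumBy-map f g xs)

  sumBy-concatMap : (f : A′ → ℕ) (g : A → List A′) (xs : List A) →
    sumBy f (concatMap g xs) ≡ sumBy (λ x → sumBy f (g x)) xs
  sumBy-concatMap f g [] = refl
  sumBy-concatMap f g (x ∷ xs) =
    trans (sumBy-++ f (g x) (concatMap g xs)) (cong (sumBy f (g x) +_) (sumBy-concatMap f g xs))

  sumBy-cong : {f g : A → ℕ} (xs : List A) → (∀ x → f x ≡ g x) → sumBy f xs ≡ sumBy g xs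
  sumBy-cong [] e = refl
  sumBy-cong (x ∷ xs) e = cong₂ _+_ (e x) (sumBy-cong xs e)

  sumBy-congAll : {P : A → Set} {f g : A → ℕ} (xs : List A) → All P xs → (∀ x → P x → f x ≡ g x) →
    sumBy f xs ≡ sumBy g xs
  sumBy-congAll [] [] e = refl
  sumBy-congAll (x ∷ xs) (p ∷ ps) e = cong₂ _+_ (e x p) (sumBy-congAll xs ps e)

  sumBy-+ : (f g : A → ℕ) (xs : List A) → sumBy (λ x → f x + g x) xs ≡ sumBy f xs + sumBy g xs
  sumBy-+ f g [] = refl
  sumBy-+ f g (x ∷ xs) =
    trans (cong (f x + g x +_) (sumBy-+ f g xs)) (+-interchange (f x) (g x) (sumBy f xs) (sumBy g xs))

  sumBy-zero : (xs : List A) → sumBy (λ _ → 0) xs ≡ 0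
  sumBy-zero [] = refl
  sumBy-zero (x ∷ xs) = sumBy-zero xs

  sumBy-swap : (f : A → A′ → ℕ) (xs : List A) (ys : List A′) →
    sumBy (λ x → sumBy (f x) ys) xs ≡ sumBy (λ y → sumBy (λ x → f x y) xs) ys
  sumBy-swap f [] ys = sym (sumBy-zero ys)
  sumBy-swap f (x ∷ xs) ys =
    trans (cong (sumBy (f x) ys +_) (sumBy-swap f xs ys)) (sym (sumBy-+ (f x) (λ y → sumBy (λ x → f x y) xs) ys))

  insertions : A → List A → List (List A)
  insertions x [] = (x ∷ []) ∷ []
  insertions x (y ∷ ys) = (x ∷ y ∷ ys) ∷ map (y ∷_) (insertions x ys)

  permutations : List A → List (List A)
  permutations [] = [] ∷ []
  permutations (x ∷ xs) = concatMap (insertions x) (permutations xs)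

  insertEverywhere≡insertions : (x : ℕ) (xs : List ℕ) → insertEverywhere x xs ≡ insertions x xs
  insertEverywhere≡insertions x [] = refl
  insertEverywhere≡insertions x (y ∷ ys) = cong (λ z → (x ∷ y ∷ ys) ∷ map (y ∷_) z) (insertEverywhere≡insertions x ys)

  perms≡permutations : (xs : List ℕ) → perms xs ≡ permutations xs
  perms≡permutations [] = refl
  perms≡permutations (x ∷ xs) =
    trans (cong (concatMap (insertEverywhere x)) (perms≡permutations xs))
          (concatMap-cong (insertEverywhere≡insertions x) (permutations xs))

  sumBy-insertions-∷ : (x z : A) (w : List A) (f : List A → ℕ) →
    sumBy f (insertions x (z ∷ w)) ≡ f (x ∷ z ∷ w) + sumBy (f ∘ (z ∷_)) (insertions x w)
  sumBy-insertions-∷ x z w f = cong (f (x ∷ z ∷ w) +_) (sumBy-map f (z ∷_) (insertions x w))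

  sumBy-insertions-comm : (x y : A) (p : List A) (f : List A → ℕ) →
    sumBy f (concatMap (insertions x) (insertions y p)) ≡ sumBy f (concatMap (insertions y) (insertions x p))
  sumBy-insertions-comm x y [] f = swap (f (x ∷ y ∷ [])) (f (y ∷ x ∷ []))
    where
    swap : ∀ a b → a + (b + 0) ≡ b + (a + 0)
    swap = solve-∀
  sumBy-insertions-comm {A = Elem} x y (z ∷ zs) f = begin
      sumBy f (concatMap (insertions x) (insertions y (z ∷ zs)))
    ≡⟨ expand x y ⟩
      f (x ∷ y ∷ z ∷ zs) + f (y ∷ x ∷ z ∷ zs) + S y x + S x y + R x y
    ≡⟨ rearrange (f (x ∷ y ∷ z ∷ zs)) (f (y ∷ x ∷ z ∷ zs)) (S y x) (S x y) (R x y) ⟩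
      f (y ∷ x ∷ z ∷ zs) + f (x ∷ y ∷ z ∷ zs) + S x y + S y x + R x y
    ≡⟨ cong (f (y ∷ x ∷ z ∷ zs) + f (x ∷ y ∷ z ∷ zs) + S x y + S y x +_) (sumBy-insertions-comm x y zs (f ∘ (z ∷_))) ⟩
      f (y ∷ x ∷ z ∷ zs) + f (x ∷ y ∷ z ∷ zs) + S x y + S y x + R y x
    ≡⟨ sym (expand y x) ⟩
      sumBy f (concatMap (insertions y) (insertions x (z ∷ zs))) ∎
    where
    open ≡-Reasoning
    S : Elem → Elem → ℕ
    S u v = sumBy (f ∘ (u ∷_) ∘ (z ∷_)) (insertions v zs)
    R : Elem → Elem → ℕ
    R u v = sumBy (f ∘ (z ∷_)) (concatMap (insertions u) (insertions v zs))
    rearrange : ∀ a b c d e → a + b + c + d + e ≡ b + a + d + c + e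
    rearrange = solve-∀
    reassoc : ∀ a b c d e → a + (b + c) + (d + e) ≡ a + b + c + d + e
    reassoc = solve-∀
    expand : ∀ u v → sumBy f (concatMap (insertions u) (insertions v (z ∷ zs))) ≡
      f (u ∷ v ∷ z ∷ zs) + f (v ∷ u ∷ z ∷ zs) + S v u + S u v + R u v
    expand u v = begin
        sumBy f (concatMap (insertions u) (insertions v (z ∷ zs)))
      ≡⟨ sumBy-++ f (insertions u (v ∷ z ∷ zs)) _ ⟩
        sumBy f (insertions u (v ∷ z ∷ zs)) + sumBy f (concatMap (insertions u) (map (z ∷_) (insertions v zs)))
      ≡⟨ cong₂ _+_ (trans (sumBy-insertions-∷ u v (z ∷ zs) f)
          (cong (f (u ∷ v ∷ z ∷ zs) +_) (sumBy-insertions-∷ u z zs (f ∘ (v ∷_)))))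
                   (trans (sumBy-concatMap f (insertions u) (map (z ∷_) (insertions v zs)))
                   (trans (sumBy-map (λ q → sumBy f (insertions u q)) (z ∷_) (insertions v zs))
                   (trans (sumBy-cong (insertions v zs) (λ w → sumBy-insertions-∷ u z w f))
                   (trans (sumBy-+ (λ w → f (u ∷ z ∷ w)) (λ w → sumBy (f ∘ (z ∷_)) (insertions u w)) (insertions v zs))
                          (cong (S u v +_) (sym (sumBy-concatMap (f ∘ (z ∷_)) (insertions u) (insertions v zs)))))))) ⟩
        f (u ∷ v ∷ z ∷ zs) + (f (v ∷ u ∷ z ∷ zs) + S v u) + (S u v + R u v)
      ≡⟨ reassoc (f (u ∷ v ∷ z ∷ zs)) (f (v ∷ u ∷ z ∷ zs)) (S v u) (S u v) (R u v) ⟩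
        f (u ∷ v ∷ z ∷ zs) + f (v ∷ u ∷ z ∷ zs) + S v u + S u v + R u v ∎

  sumBy-permutations-↭ : {xs ys : List A} → xs ↭ ys → (f : List A → ℕ) →
    sumBy f (permutations xs) ≡ sumBy f (permutations ys)
  sumBy-permutations-↭ ↭.refl f = refl
  sumBy-permutations-↭ (↭.prep {xs} {ys} x p) f = begin
      sumBy f (concatMap (insertions x) (permutations xs))
    ≡⟨ sumBy-concatMap f (insertions x) (permutations xs) ⟩
      sumBy (λ q → sumBy f (insertions x q)) (permutations xs)
    ≡⟨ sumBy-permutations-↭ p (λ q → sumBy f (insertions x q)) ⟩
      sumBy (λ q → sumBy f (insertions x q)) (permutations ys)
    ≡⟨ sym (sumBy-concatMap f (insertions x) (permutations ys)) ⟩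
      sumBy f (concatMap (insertions x) (permutations ys)) ∎
    where open ≡-Reasoning
  sumBy-permutations-↭ (↭.swap {xs} {ys} x y p) f = begin
      sumBy f (concatMap (insertions x) (concatMap (insertions y) (permutations xs)))
    ≡⟨ sumBy-concatMap f (insertions x) (concatMap (insertions y) (permutations xs)) ⟩
      sumBy (λ q → sumBy f (insertions x q)) (concatMap (insertions y) (permutations xs))
    ≡⟨ sumBy-concatMap (λ q → sumBy f (insertions x q)) (insertions y) (permutations xs) ⟩
      sumBy (λ q → sumBy (λ r → sumBy f (insertions x r)) (insertions y q)) (permutations xs)
    ≡⟨ sumBy-cong (permutations xs) swapInsertions ⟩
      sumBy (λ q → sumBy (λ r → sumBy f (insertions y r)) (insertions x q)) (permutations xs)
    ≡⟨ sumBy-permutations-↭ p (λ q → sumBy (λ r → sumBy f (insertions y r)) (insertions x q)) ⟩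
      sumBy (λ q → sumBy (λ r → sumBy f (insertions y r)) (insertions x q)) (permutations ys)
    ≡⟨ sym (sumBy-concatMap (λ q → sumBy f (insertions y q)) (insertions x) (permutations ys)) ⟩
      sumBy (λ q → sumBy f (insertions y q)) (concatMap (insertions x) (permutations ys))
    ≡⟨ sym (sumBy-concatMap f (insertions y) (concatMap (insertions x) (permutations ys))) ⟩
      sumBy f (concatMap (insertions y) (concatMap (insertions x) (permutations ys))) ∎
    where
    open ≡-Reasoning
    swapInsertions : ∀ q → sumBy (λ r → sumBy f (insertions x r)) (insertions y q)
                         ≡ sumBy (λ r → sumBy f (insertions y r)) (insertions x q)
    swapInsertions q = trans (sym (sumBy-concatMap f (insertions x) (insertions y q)))
                      (trans (sumBy-insertions-comm x y q f) (sumBy-concatMap f (insertions y) (insertions x q)))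
  sumBy-permutations-↭ (↭.trans p q) f = trans (sumBy-permutations-↭ p f) (sumBy-permutations-↭ q f)

  insertions-∷ʳ : (x z : A) (ys : List A) → insertions x (ys ∷ʳ z) ≡ map (_∷ʳ z) (insertions x ys) ∷ʳ ((ys ∷ʳ z) ∷ʳ x)
  insertions-∷ʳ x z [] = refl
  insertions-∷ʳ x z (y ∷ ys) = cong ((x ∷ y ∷ ys ∷ʳ z) ∷_) (begin
      map (y ∷_) (insertions x (ys ∷ʳ z))
    ≡⟨ cong (map (y ∷_)) (insertions-∷ʳ x z ys) ⟩
      map (y ∷_) (map (_∷ʳ z) (insertions x ys) ∷ʳ ((ys ∷ʳ z) ∷ʳ x))
    ≡⟨ map-++ (y ∷_) (map (_∷ʳ z) (insertions x ys)) _ ⟩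
      map (y ∷_) (map (_∷ʳ z) (insertions x ys)) ∷ʳ (y ∷ (ys ∷ʳ z) ∷ʳ x)
    ≡⟨ cong (_∷ʳ (y ∷ (ys ∷ʳ z) ∷ʳ x)) (trans (sym (map-∘ (insertions x ys))) (map-∘ (insertions x ys))) ⟩
      map (_∷ʳ z) (map (y ∷_) (insertions x ys)) ∷ʳ (y ∷ (ys ∷ʳ z) ∷ʳ x) ∎)
    where open ≡-Reasoning

  sumBy-reverse-insertions : (x : A) (p : List A) (f : List A → ℕ) → sumBy (f ∘ reverse) (insertions x p)
      ≡ sumBy f (insertions x (reverse p))
  sumBy-reverse-insertions x [] f = refl
  sumBy-reverse-insertions x (z ∷ zs) f = begin
      f (reverse (x ∷ z ∷ zs)) + sumBy (f ∘ reverse) (map (z ∷_) (insertions x zs))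
    ≡⟨ cong (f (reverse (x ∷ z ∷ zs)) +_)
        (trans (sumBy-map (f ∘ reverse) (z ∷_) (insertions x zs))
        (sumBy-cong (insertions x zs) (λ w → cong f (unfold-reverse z w)))) ⟩
      f (reverse (x ∷ z ∷ zs)) + sumBy (λ w → f (reverse w ∷ʳ z)) (insertions x zs)
    ≡⟨ cong (f (reverse (x ∷ z ∷ zs)) +_) (sumBy-reverse-insertions x zs (λ w → f (w ∷ʳ z))) ⟩
      f (reverse (x ∷ z ∷ zs)) + sumBy (λ w → f (w ∷ʳ z)) (insertions x (reverse zs))
    ≡⟨ +-comm (f (reverse (x ∷ z ∷ zs))) (sumBy (λ w → f (w ∷ʳ z)) (insertions x (reverse zs))) ⟩
      sumBy (λ w → f (w ∷ʳ z)) (insertions x (reverse zs)) + f (reverse (x ∷ z ∷ zs))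
    ≡⟨ cong₂ _+_ (sym (sumBy-map f (_∷ʳ z) (insertions x (reverse zs))))
        (cong f (trans (unfold-reverse x (z ∷ zs)) (cong (_∷ʳ x) (unfold-reverse z zs)))) ⟩
      sumBy f (map (_∷ʳ z) (insertions x (reverse zs))) + f ((reverse zs ∷ʳ z) ∷ʳ x)
    ≡⟨ sym (sumBy-∷ʳ f (map (_∷ʳ z) (insertions x (reverse zs))) ((reverse zs ∷ʳ z) ∷ʳ x)) ⟩
      sumBy f (map (_∷ʳ z) (insertions x (reverse zs)) ∷ʳ ((reverse zs ∷ʳ z) ∷ʳ x))
    ≡⟨ cong (sumBy f) (sym (insertions-∷ʳ x z (reverse zs))) ⟩
      sumBy f (insertions x (reverse zs ∷ʳ z))
    ≡⟨ cong (λ u → sumBy f (insertions x u)) (sym (unfold-reverse z zs)) ⟩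
      sumBy f (insertions x (reverse (z ∷ zs))) ∎
    where open ≡-Reasoning

  sumBy-permutations-reverse : (xs : List A) (f : List A → ℕ) → sumBy (f ∘ reverse) (permutations xs)
      ≡ sumBy f (permutations xs)
  sumBy-permutations-reverse [] f = refl
  sumBy-permutations-reverse (x ∷ xs) f = begin
      sumBy (f ∘ reverse) (concatMap (insertions x) (permutations xs))
    ≡⟨ sumBy-concatMap (f ∘ reverse) (insertions x) (permutations xs) ⟩
      sumBy (λ p → sumBy (f ∘ reverse) (insertions x p)) (permutations xs)
    ≡⟨ sumBy-cong (permutations xs) (λ p → sumBy-reverse-insertions x p f) ⟩
      sumBy (λ p → sumBy f (insertions x (reverse p))) (permutations xs)
    ≡⟨ sumBy-permutations-reverse xs (λ p → sumBy f (insertions x p)) ⟩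
      sumBy (λ p → sumBy f (insertions x p)) (permutations xs)
    ≡⟨ sym (sumBy-concatMap f (insertions x) (permutations xs)) ⟩
      sumBy f (concatMap (insertions x) (permutations xs)) ∎
    where open ≡-Reasoning

  picks : List A → List (A × List A)
  picks [] = []
  picks (x ∷ xs) = (x , xs) ∷ map (λ cr → (proj₁ cr , x ∷ proj₂ cr)) (picks xs)

  sumBy-permutations-head : (x : A) (xs : List A) (f : List A → ℕ) →
    sumBy f (permutations (x ∷ xs)) ≡ sumBy (λ cr → sumBy (λ p → f (proj₁ cr ∷ p)) (permutations (proj₂ cr)))
        (picks (x ∷ xs))
  sumBy-permutations-head x [] f = sym (+-identityʳ _)
  sumBy-permutations-head x (y ∷ ys) f = begin
      sumBy f (concatMap (insertions x) (permutations (y ∷ ys)))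
    ≡⟨ sumBy-concatMap f (insertions x) (permutations (y ∷ ys)) ⟩
      sumBy (λ p → sumBy f (insertions x p)) (permutations (y ∷ ys))
    ≡⟨ sumBy-permutations-head y ys (λ p → sumBy f (insertions x p)) ⟩
      sumBy (λ cr → sumBy (λ p → sumBy f (insertions x (proj₁ cr ∷ p))) (permutations (proj₂ cr))) (picks (y ∷ ys))
    ≡⟨ sumBy-cong (picks (y ∷ ys)) (λ cr → trans
        (sumBy-cong (permutations (proj₂ cr)) (λ p → sumBy-insertions-∷ x (proj₁ cr) p f))
        (sumBy-+ (λ p → f (x ∷ proj₁ cr ∷ p)) (λ p → sumBy (λ q → f (proj₁ cr ∷ q)) (insertions x p))
        (permutations (proj₂ cr)))) ⟩
      sumBy (λ cr → sumBy (λ p → f (x ∷ proj₁ cr ∷ p)) (permutations (proj₂ cr))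
          + sumBy (λ p → sumBy (λ q → f (proj₁ cr ∷ q)) (insertions x p)) (permutations (proj₂ cr))) (picks (y ∷ ys))
    ≡⟨ sumBy-+ (λ cr → sumBy (λ p → f (x ∷ proj₁ cr ∷ p)) (permutations (proj₂ cr)))
        (λ cr → sumBy (λ p → sumBy (λ q → f (proj₁ cr ∷ q)) (insertions x p)) (permutations (proj₂ cr)))
        (picks (y ∷ ys)) ⟩
      sumBy (λ cr → sumBy (λ p → f (x ∷ proj₁ cr ∷ p)) (permutations (proj₂ cr))) (picks (y ∷ ys))
          + sumBy (λ cr → sumBy (λ p → sumBy (λ q → f (proj₁ cr ∷ q)) (insertions x p))
          (permutations (proj₂ cr))) (picks (y ∷ ys))
    ≡⟨ cong₂ _+_ (sym (sumBy-permutations-head y ys (λ p → f (x ∷ p))))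
        (trans (sumBy-cong (picks (y ∷ ys))
        (λ cr → sym (sumBy-concatMap (λ q → f (proj₁ cr ∷ q)) (insertions x) (permutations (proj₂ cr)))))
        (sym (sumBy-map (λ cr → sumBy (λ p → f (proj₁ cr ∷ p)) (permutations (proj₂ cr)))
        (λ cr → (proj₁ cr , x ∷ proj₂ cr)) (picks (y ∷ ys))))) ⟩
      sumBy (λ p → f (x ∷ p)) (permutations (y ∷ ys))
        + sumBy (λ cr → sumBy (λ p → f (proj₁ cr ∷ p)) (permutations (proj₂ cr)))
                (map (λ cr → (proj₁ cr , x ∷ proj₂ cr)) (picks (y ∷ ys)))
    ∎
    where open ≡-Reasoning

  sumBy-permutations-last : (x : A) (xs : List A) (f : List A → ℕ) →
    sumBy f (permutations (x ∷ xs)) ≡ sumBy (λ cr → sumBy (λ p → f (p ∷ʳ proj₁ cr)) (permutations (proj₂ cr)))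
        (picks (x ∷ xs))
  sumBy-permutations-last x xs f = begin
      sumBy f (permutations (x ∷ xs))
    ≡⟨ sym (sumBy-permutations-reverse (x ∷ xs) f) ⟩
      sumBy (f ∘ reverse) (permutations (x ∷ xs))
    ≡⟨ sumBy-permutations-head x xs (f ∘ reverse) ⟩
      sumBy (λ cr → sumBy (λ p → f (reverse (proj₁ cr ∷ p))) (permutations (proj₂ cr))) (picks (x ∷ xs))
    ≡⟨ sumBy-cong (picks (x ∷ xs)) (λ cr → trans
        (sumBy-cong (permutations (proj₂ cr)) (λ p → cong f (unfold-reverse (proj₁ cr) p)))
        (sumBy-permutations-reverse (proj₂ cr) (λ p → f (p ∷ʳ proj₁ cr)))) ⟩
      sumBy (λ cr → sumBy (λ p → f (p ∷ʳ proj₁ cr)) (permutations (proj₂ cr))) (picks (x ∷ xs)) ∎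
    where open ≡-Reasoning

  false≢true : false ≢ true
  false≢true ()

  ∧-left-comm : ∀ a b c → (a ∧ (b ∧ c)) ≡ (b ∧ (a ∧ c))
  ∧-left-comm true b c = refl
  ∧-left-comm false true c = refl
  ∧-left-comm false false c = refl

  ∨-left-comm : ∀ a b c → (a ∨ (b ∨ c)) ≡ (b ∨ (a ∨ c))
  ∨-left-comm true true c = refl
  ∨-left-comm true false c = refl
  ∨-left-comm false b c = refl

  sameCell : Cell → Cell → Bool
  sameCell a b = (proj₁ a ≡ᵇ proj₁ b) ∧ (proj₂ a ≡ᵇ proj₂ b)

  ≡ᵇ-refl : ∀ n → (n ≡ᵇ n) ≡ true
  ≡ᵇ-refl zero = refl
  ≡ᵇ-refl (suc n) = ≡ᵇ-refl n

  ≡ᵇ-true : ∀ m n → (m ≡ᵇ n) ≡ true → m ≡ n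
  ≡ᵇ-true m n e = ≡ᵇ⇒≡ m n (subst T (sym e) tt)

  sameCell-refl : (a : Cell) → sameCell a a ≡ true
  sameCell-refl (r , j) rewrite ≡ᵇ-refl r | ≡ᵇ-refl j = refl

  ∧-true : ∀ a b → (a ∧ b) ≡ true → (a ≡ true) × (b ≡ true)
  ∧-true true true e = refl , refl

  sameCell⇒≡ : (a b : Cell) → sameCell a b ≡ true → a ≡ b
  sameCell⇒≡ (r , j) (r' , j') e with ∧-true (r ≡ᵇ r') (j ≡ᵇ j') e
  ... | e1 , e2 = cong₂ _,_ (≡ᵇ-true r r' e1) (≡ᵇ-true j j' e2)

  Fresh : Cell → List Cell → Set
  Fresh c = All (λ x → sameCell c x ≡ false)

  Distinct : List Cell → Set
  Distinct [] = ⊤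
  Distinct (x ∷ xs) = Fresh x xs × Distinct xs

  RespectsVal : (Filling → Bool) → Set
  RespectsVal P = ∀ T1 T2 → (∀ x → val T1 x ≡ val T2 x) → P T1 ≡ P T2

  RespectsVal-∷ : (P : Filling → Bool) → RespectsVal P → (c : Cell) (v : ℕ) → RespectsVal (λ T → P ((c , v) ∷ T))
  RespectsVal-∷ P r c v T1 T2 e = r _ _ (λ x → cong (if sameCell c x then v else_) (e x))

  val-swap : (c s : Cell) (v w : ℕ) (T : Filling) → sameCell c s ≡ false → ∀ x →
    val ((s , v) ∷ (c , w) ∷ T) x ≡ val ((c , w) ∷ (s , v) ∷ T) x
  val-swap c s v w T ne x with sameCell s x in e1 | sameCell c x in e2
  ... | true | true = ⊥-elim (false≢true
      (trans (sym ne) (subst (λ z → sameCell c z ≡ true) (sym (sameCell⇒≡ s x e1)) e2)))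
  ... | true | false = refl
  ... | false | true = refl
  ... | false | false = refl

  indicator : (A → Bool) → A → ℕ
  indicator p x = if p x then 1 else 0

  count≡sumBy-indicator : (p : A → Bool) (xs : List A) → count p xs ≡ sumBy (indicator p) xs
  count≡sumBy-indicator p [] = refl
  count≡sumBy-indicator p (x ∷ xs) with p x
  ... | true = cong suc (count≡sumBy-indicator p xs)
  ... | false = count≡sumBy-indicator p xs

  All-insertions : (Q : A → Set) (x : A) (σ : List A) → Q x → All Q σ
      → All (λ τ → All Q τ × length τ ≡ suc (length σ)) (insertions x σ)
  All-insertions Q x [] q [] = ((q ∷ []) , refl) ∷ []
  All-insertions Q x (y ∷ σ) q (qy ∷ qσ) = ((q ∷ qy ∷ qσ) , refl) ∷ map⁺
      (All.map (λ {τ} h → (qy ∷ proj₁ h) , cong suc (proj₂ h)) (All-insertions Q x σ q qσ))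

  All-permutations : (Q : A → Set) (xs : List A) → All Q xs → All (λ σ → All Q σ × length σ ≡ length xs)
      (permutations xs)
  All-permutations Q [] [] = ([] , refl) ∷ []
  All-permutations Q (x ∷ xs) (q ∷ qs) = concat⁺
      (map⁺ (All.map (λ {σ} h → All.map (λ {τ} h' → proj₁ h' , trans (proj₂ h') (cong suc (proj₂ h)))
      (All-insertions Q x σ q (proj₁ h))) (All-permutations Q xs qs)))

  picks-length : (R : List A) → All (λ vr → suc (length (proj₂ vr)) ≡ length R) (picks R)
  picks-length [] = []
  picks-length (x ∷ R) = refl ∷ map⁺ (All.map (λ {vr} e → cong suc e) (picks-length R))

  inversion-insertions : (P : Filling → Bool) → RespectsVal P → (c : Cell) (σ : List Cell) (R : List ℕ) →
    Fresh c σ → suc (length σ) ≡ length R →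
    sumBy (λ τ → indicator P (zip τ R)) (insertions c σ)
      ≡ sumBy (λ vr → indicator P ((c , proj₁ vr) ∷ zip σ (proj₂ vr))) (picks R)
  inversion-insertions P rP c [] (v ∷ []) ni e = refl
  inversion-insertions P rP c (s ∷ σ) (v ∷ R) (ns ∷ ni) e = cong (indicator P ((c , v) ∷ zip (s ∷ σ) R) +_) (begin
      sumBy (λ τ → indicator P (zip τ (v ∷ R))) (map (s ∷_) (insertions c σ))
    ≡⟨ sumBy-map (λ τ → indicator P (zip τ (v ∷ R))) (s ∷_) (insertions c σ) ⟩
      sumBy (λ τ → indicator (λ T → P ((s , v) ∷ T)) (zip τ R)) (insertions c σ)
    ≡⟨ inversion-insertions (λ T → P ((s , v) ∷ T)) (RespectsVal-∷ P rP s v) c σ R ni (suc-injective e) ⟩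
      sumBy (λ wr → indicator P ((s , v) ∷ (c , proj₁ wr) ∷ zip σ (proj₂ wr))) (picks R)
    ≡⟨ sumBy-cong (picks R) (λ wr → cong (λ b → if b then 1 else 0)
        (rP _ _ (val-swap c s v (proj₁ wr) (zip σ (proj₂ wr)) ns))) ⟩
      sumBy (λ wr → indicator P ((c , proj₁ wr) ∷ (s , v) ∷ zip σ (proj₂ wr))) (picks R)
    ≡⟨ sym (sumBy-map (λ vr → indicator P ((c , proj₁ vr) ∷ zip (s ∷ σ) (proj₂ vr)))
        (λ cr → (proj₁ cr , v ∷ proj₂ cr)) (picks R)) ⟩
      sumBy (λ vr → indicator P ((c , proj₁ vr) ∷ zip (s ∷ σ) (proj₂ vr)))
          (map (λ cr → (proj₁ cr , v ∷ proj₂ cr)) (picks R)) ∎)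
    where open ≡-Reasoning

  sumBy-permutations-inversion : (cs : List Cell) (R : List ℕ) → length cs ≡ length R → Distinct cs
      → (P : Filling → Bool) → RespectsVal P →
    sumBy (λ p → indicator P (zip cs p)) (permutations R) ≡ sumBy (λ σ → indicator P (zip σ R)) (permutations cs)
  sumBy-permutations-inversion [] [] e d P rP = refl
  sumBy-permutations-inversion (c ∷ cs) (v ∷ R) e (nc , d) P rP = begin
      sumBy (λ p → indicator P (zip (c ∷ cs) p)) (permutations (v ∷ R))
    ≡⟨ sumBy-permutations-head v R (λ p → indicator P (zip (c ∷ cs) p)) ⟩
      sumBy (λ vr → sumBy (λ p → indicator P (zip (c ∷ cs) (proj₁ vr ∷ p))) (permutations (proj₂ vr))) (picks (v ∷ R))
    ≡⟨ sumBy-congAll (picks (v ∷ R)) (picks-length (v ∷ R))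
        (λ vr l → sumBy-permutations-inversion cs (proj₂ vr) (suc-injective (trans e (sym l))) d
        (λ T → P ((c , proj₁ vr) ∷ T)) (RespectsVal-∷ P rP c (proj₁ vr))) ⟩
      sumBy (λ vr → sumBy (λ σ → indicator P ((c , proj₁ vr) ∷ zip σ (proj₂ vr))) (permutations cs)) (picks (v ∷ R))
    ≡⟨ sumBy-swap (λ vr σ → indicator P ((c , proj₁ vr) ∷ zip σ (proj₂ vr))) (picks (v ∷ R)) (permutations cs) ⟩
      sumBy (λ σ → sumBy (λ vr → indicator P ((c , proj₁ vr) ∷ zip σ (proj₂ vr))) (picks (v ∷ R))) (permutations cs)
    ≡⟨ sym (sumBy-congAll (permutations cs) (All-permutations (λ x → sameCell c x ≡ false) cs nc)
        (λ σ h → inversion-insertions P rP c σ (v ∷ R) (proj₁ h) (trans (cong suc (proj₂ h)) e))) ⟩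
      sumBy (λ σ → sumBy (λ τ → indicator P (zip τ (v ∷ R))) (insertions c σ)) (permutations cs)
    ≡⟨ sym (sumBy-concatMap (λ τ → indicator P (zip τ (v ∷ R))) (insertions c) (permutations cs)) ⟩
      sumBy (λ σ → indicator P (zip σ (v ∷ R))) (permutations (c ∷ cs)) ∎
    where open ≡-Reasoning

  -- σ lists the cells receiving the entries 1, 2, …, |cs| in this order.
  countByCells : List Cell → (Filling → Bool) → ℕ
  countByCells cs P = sumBy (λ σ → indicator P (zip σ (range1 (length cs)))) (permutations cs)

  count-fillings : (cs : List Cell) → Distinct cs → (P : Filling → Bool) → RespectsVal P
      → count P (fillings cs) ≡ countByCells cs P
  count-fillings cs d P rP = begin
      count P (fillings cs)
    ≡⟨ count≡sumBy-indicator P (fillings cs) ⟩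
      sumBy (indicator P) (map (zip cs) (perms (range1 (length cs))))
    ≡⟨ sumBy-map (indicator P) (zip cs) (perms (range1 (length cs))) ⟩
      sumBy (λ p → indicator P (zip cs p)) (perms (range1 (length cs)))
    ≡⟨ cong (sumBy (λ p → indicator P (zip cs p))) (perms≡permutations (range1 (length cs))) ⟩
      sumBy (λ p → indicator P (zip cs p)) (permutations (range1 (length cs)))
    ≡⟨ sumBy-permutations-inversion cs (range1 (length cs)) (sym (length-applyUpTo suc (length cs))) d P rP ⟩
      countByCells cs P ∎
    where open ≡-Reasoning

  range1-suc : ∀ n → range1 (suc n) ≡ range1 n ∷ʳ suc n
  range1-suc n = sym (applyUpTo-∷ʳ suc n)

  zip-∷ʳ : (xs : List A) (ys : List A′) (a : A) (b : A′) → length xs ≡ length ys → zip (xs ∷ʳ a) (ys ∷ʳ b)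
      ≡ zip xs ys ∷ʳ (a , b)
  zip-∷ʳ [] [] a b e = refl
  zip-∷ʳ (x ∷ xs) (y ∷ ys) a b e = cong ((x , y) ∷_) (zip-∷ʳ xs ys a b (suc-injective e))

  -- Split according to the cell receiving the largest entry.
  countByCells-last : (x : Cell) (xs : List Cell) (P : Filling → Bool) →
    countByCells (x ∷ xs) P ≡ sumBy (λ cr → countByCells (proj₂ cr)
        (λ T → P (T ∷ʳ (proj₁ cr , suc (length (proj₂ cr)))))) (picks (x ∷ xs))
  countByCells-last x xs P = trans (sumBy-permutations-last x xs (λ σ → indicator P (zip σ (range1 (length (x ∷ xs))))))
    (sumBy-congAll (picks (x ∷ xs)) (picks-length (x ∷ xs))
        (λ cr e → sumBy-congAll (permutations (proj₂ cr))
        (All-permutations (λ _ → ⊤) (proj₂ cr) (All.universal (λ _ → tt) _))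
      (λ p h → cong (indicator P) (trans
          (cong (zip (p ∷ʳ proj₁ cr)) (trans (cong range1 (sym e)) (range1-suc (length (proj₂ cr)))))
         (zip-∷ʳ p (range1 (length (proj₂ cr))) (proj₁ cr) (suc (length (proj₂ cr)))
             (trans (proj₂ h) (sym (length-applyUpTo suc _))))))))

  countByCells-congAll : (I : Cell → Set) (r : List Cell) → All I r → (P Q : Filling → Bool) →
    (∀ σ → All I σ → length σ ≡ length r → P (zip σ (range1 (length r))) ≡ Q (zip σ (range1 (length r))))
        → countByCells r P ≡ countByCells r Q
  countByCells-congAll I r allI P Q h = sumBy-congAll (permutations r) (All-permutations I r allI)
      (λ σ hσ → cong (λ b → if b then 1 else 0) (h σ (proj₁ hσ) (proj₂ hσ)))

  sameCell-sym : (a b : Cell) → sameCell a b ≡ sameCell b a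
  sameCell-sym (r , j) (r' , j') = cong₂ _∧_ (≡ᵇ-sym r r') (≡ᵇ-sym j j')
    where
    ≡ᵇ-sym : ∀ m n → (m ≡ᵇ n) ≡ (n ≡ᵇ m)
    ≡ᵇ-sym zero zero = refl
    ≡ᵇ-sym zero (suc n) = refl
    ≡ᵇ-sym (suc m) zero = refl
    ≡ᵇ-sym (suc m) (suc n) = ≡ᵇ-sym m n

  val-∷ʳ-other : (T : Filling) (c x : Cell) (v : ℕ) → sameCell c x ≡ false → val (T ∷ʳ (c , v)) x ≡ val T x
  val-∷ʳ-other [] c x v e rewrite e = refl
  val-∷ʳ-other ((d , w) ∷ T) c x v e with sameCell d x
  ... | true = refl
  ... | false = val-∷ʳ-other T c x v e

  val-∷ʳ-self : (σ : List Cell) (R : List ℕ) (c : Cell) (v : ℕ) → Fresh c σ → val (zip σ R ∷ʳ (c , v)) c ≡ v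
  val-∷ʳ-self [] R c v ni rewrite sameCell-refl c = refl
  val-∷ʳ-self (s ∷ σ) [] c v ni rewrite sameCell-refl c = refl
  val-∷ʳ-self (s ∷ σ) (w ∷ R) c v (n ∷ ni) rewrite sameCell-sym s c | n = val-∷ʳ-self σ R c v ni

  All-range1 : ∀ n → All (λ j → 1 ≤ j × j ≤ n) (range1 n)
  All-range1 zero = []
  All-range1 (suc n) = subst (All (λ j → 1 ≤ j × j ≤ suc n)) (sym (range1-suc n))
    (++⁺ (All.map (λ {j} h → proj₁ h , m≤n⇒m≤1+n (proj₂ h)) (All-range1 n)) ((s≤s z≤n , ≤-refl) ∷ []))

  val-≤ : (σ : List Cell) (R : List ℕ) (n : ℕ) → All (_≤ n) R → ∀ x → val (zip σ R) x ≤ n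
  val-≤ [] R n a x = z≤n
  val-≤ (s ∷ σ) [] n a x = z≤n
  val-≤ (s ∷ σ) (w ∷ R) n (aw ∷ a) x with sameCell s x
  ... | true = aw
  ... | false = val-≤ σ R n a x

  val-range1-≤ : (σ : List Cell) (n : ℕ) → ∀ x → val (zip σ (range1 n)) x ≤ n
  val-range1-≤ σ n = val-≤ σ (range1 n) n (All.map (λ {j} h → proj₂ h) (All-range1 n))

  update : (Cell → ℕ) → Cell → ℕ → Cell → ℕ
  update g c v x = if sameCell c x then v else g x

  val-∷ʳ≗update : (σ : List Cell) (R : List ℕ) (c : Cell) (v : ℕ) → Fresh c σ → ∀ x
      → val (zip σ R ∷ʳ (c , v)) x ≡ update (val (zip σ R)) c v x
  val-∷ʳ≗update σ R c v ni x with sameCell c x in e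
  ... | true = subst (λ z → val (zip σ R ∷ʳ (c , v)) z ≡ v) (sameCell⇒≡ c x e) (val-∷ʳ-self σ R c v ni)
  ... | false = val-∷ʳ-other (zip σ R) c x v e

  <ᵇ-true : ∀ {m n} → m < n → (m <ᵇ n) ≡ true
  <ᵇ-true {zero} {suc n} p = refl
  <ᵇ-true {suc m} {suc n} (s≤s p) = <ᵇ-true p

  <ᵇ-false : ∀ {m n} → n ≤ m → (m <ᵇ n) ≡ false
  <ᵇ-false {m} {zero} p = refl
  <ᵇ-false {suc m} {suc n} (s≤s p) = <ᵇ-false p

  ≡ᵇ-false : ∀ {m n} → ¬ m ≡ n → (m ≡ᵇ n) ≡ false
  ≡ᵇ-false {zero} {zero} ne = ⊥-elim (ne refl)
  ≡ᵇ-false {zero} {suc n} ne = refl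
  ≡ᵇ-false {suc m} {zero} ne = refl
  ≡ᵇ-false {suc m} {suc n} ne = ≡ᵇ-false {m} {n} (λ e → ne (cong suc e))

  sameCell-≢row : ∀ r r' j j' → ¬ r ≡ r' → sameCell (r , j) (r' , j') ≡ false
  sameCell-≢row r r' j j' ne rewrite ≡ᵇ-false ne = refl

  sameCell-≢column : ∀ r j j' → ¬ j ≡ j' → sameCell (r , j) (r , j') ≡ false
  sameCell-≢column r j j' ne rewrite ≡ᵇ-refl r | ≡ᵇ-false ne = refl

  update-other : (g : Cell → ℕ) (c x : Cell) (v : ℕ) → sameCell c x ≡ false → update g c v x ≡ g x
  update-other g c x v e rewrite e = refl

  update-self : (g : Cell → ℕ) (c : Cell) (v : ℕ) → update g c v c ≡ v
  update-self g c v rewrite sameCell-refl c = refl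

  allB-++ : (p : A → Bool) (xs ys : List A) → allB p (xs ++ ys) ≡ (allB p xs ∧ allB p ys)
  allB-++ p [] ys = refl
  allB-++ p (x ∷ xs) ys rewrite allB-++ p xs ys = sym (∧-assoc (p x) (allB p xs) (allB p ys))

  allB-∷ʳ : (p : A → Bool) (xs : List A) (y : A) → allB p (xs ∷ʳ y) ≡ (allB p xs ∧ p y)
  allB-∷ʳ p xs y = trans (allB-++ p xs (y ∷ [])) (cong (allB p xs ∧_) (∧-identityʳ (p y)))

  allB-congAll : {Q : A → Set} (p q : A → Bool) (xs : List A) → All Q xs → (∀ x → Q x → p x ≡ q x) → allB p xs
      ≡ allB q xs
  allB-congAll p q [] [] h = refl
  allB-congAll p q (x ∷ xs) (a ∷ as) h = cong₂ _∧_ (h x a) (allB-congAll p q xs as h)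

  allB-cong : (p q : A → Bool) (xs : List A) → (∀ x → p x ≡ q x) → allB p xs ≡ allB q xs
  allB-cong p q [] h = refl
  allB-cong p q (x ∷ xs) h = cong₂ _∧_ (h x) (allB-cong p q xs h)

  allB-range1-false : (p : ℕ → Bool) (n j : ℕ) → 1 ≤ j → j ≤ n → p j ≡ false → allB p (range1 n) ≡ false
  allB-range1-false p zero (suc j) a () e
  allB-range1-false p (suc n) j a b e = trans (cong (allB p) (range1-suc n))
      (trans (allB-∷ʳ p (range1 n) (suc n)) (cases (m≤n⇒m<n∨m≡n b)))
    where
    cases : (j < suc n) Data.Sum.⊎ (j ≡ suc n) → (allB p (range1 n) ∧ p (suc n)) ≡ false
    cases (inj₁ (s≤s j≤n)) rewrite allB-range1-false p n j a j≤n e = refl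
    cases (inj₂ refl) rewrite e = ∧-zeroʳ _

  rowIncreasing : (Cell → ℕ) → ℕ → ℕ → Bool
  rowIncreasing g r len = allB (λ j → g (r , j) <ᵇ g (r , suc j)) (range1 (len ∸ 1))

  columnIncreasing : (Cell → ℕ) → ℕ → ℕ → List ℕ → Bool
  columnIncreasing g r r' js = allB (λ j → g (r , j) <ᵇ g (r' , j)) js

  valid₃ : ℕ → ℕ → List ℕ → (Cell → ℕ) → Bool
  valid₃ n m S g = rowIncreasing g 1 n ∧ rowIncreasing g 2 m ∧ columnIncreasing g 1 2 (range1 m)
      ∧ columnIncreasing g 2 3 S

  Below : ℕ → (Cell → ℕ) → Set
  Below N g = ∀ x → g x < N

  rowIncreasing-update-elsewhere : (g : Cell → ℕ) (c : Cell) (v r len : ℕ)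
      → (∀ j → 1 ≤ j → j ≤ len → sameCell c (r , j) ≡ false) → rowIncreasing (update g c v) r len
      ≡ rowIncreasing g r len
  rowIncreasing-update-elsewhere g c v r len h = allB-congAll _ _ (range1 (len ∸ 1)) (All-range1 (len ∸ 1))
    (λ j b → cong₂ _<ᵇ_ (update-other g c (r , j) v (h j (proj₁ b) (≤-trans (proj₂ b) (m∸n≤m len 1))))
                        (update-other g c (r , suc j) v (h (suc j) (s≤s z≤n) (suc≤len len (proj₁ b) (proj₂ b)))))
    where
    suc≤len : ∀ len {j} → 1 ≤ j → j ≤ len ∸ 1 → suc j ≤ len
    suc≤len zero a b = ⊥-elim (<⇒≱ a b)
    suc≤len (suc l) a b = s≤s b

  columnIncreasing-update-elsewhere : (g : Cell → ℕ) (c : Cell) (v r r' : ℕ) (js : List ℕ)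
      → All (λ j → (sameCell c (r , j) ≡ false) × (sameCell c (r' , j) ≡ false)) js
      → columnIncreasing (update g c v) r r' js ≡ columnIncreasing g r r' js
  columnIncreasing-update-elsewhere g c v r r' js a = allB-congAll _ _ js a
      (λ j h → cong₂ _<ᵇ_ (update-other g c (r , j) v (proj₁ h)) (update-other g c (r' , j) v (proj₂ h)))

  rowIncreasing-update-end : (g : Cell → ℕ) (N r n : ℕ) → Below N g
      → rowIncreasing (update g (r , suc n) N) r (suc n) ≡ rowIncreasing g r n
  rowIncreasing-update-end g N r zero b = refl
  rowIncreasing-update-end g N r (suc n) b = begin
      allB p (range1 (suc n))
    ≡⟨ cong (allB p) (range1-suc n) ⟩
      allB p (range1 n ∷ʳ suc n)
    ≡⟨ allB-∷ʳ p (range1 n) (suc n) ⟩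
      (allB p (range1 n) ∧ p (suc n))
    ≡⟨ cong₂ _∧_ (allB-congAll p q (range1 n) (All-range1 n)
        (λ j h → cong₂ _<ᵇ_ (update-other g (r , suc (suc n)) (r , j) N
        (sameCell-≢column r (suc (suc n)) j (λ e → <⇒≢ (s≤s (m≤n⇒m≤1+n (proj₂ h))) (sym e))))
        (update-other g (r , suc (suc n)) (r , suc j) N
        (sameCell-≢column r (suc (suc n)) (suc j) (λ e → <⇒≢ (s≤s (s≤s (proj₂ h))) (sym e))))))
                 (trans (cong₂ _<ᵇ_ (update-other g (r , suc (suc n)) (r , suc n) N
                     (sameCell-≢column r (suc (suc n)) (suc n) (λ e → <⇒≢ ≤-refl (sym e))))
                     (update-self g (r , suc (suc n)) N)) (<ᵇ-true (b (r , suc n)))) ⟩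
      (allB q (range1 n) ∧ true)
    ≡⟨ ∧-identityʳ _ ⟩
      allB q (range1 n) ∎
    where
    open ≡-Reasoning
    p = λ j → update g (r , suc (suc n)) N (r , j) <ᵇ update g (r , suc (suc n)) N (r , suc j)
    q = λ j → g (r , j) <ᵇ g (r , suc j)

  columnIncreasing-update-end : (g : Cell → ℕ) (N r r' m : ℕ) → ¬ r ≡ r' → Below N g
      → columnIncreasing (update g (r' , suc m) N) r r' (range1 (suc m)) ≡ columnIncreasing g r r' (range1 m)
  columnIncreasing-update-end g N r r' m ne b = begin
      allB p (range1 (suc m))
    ≡⟨ cong (allB p) (range1-suc m) ⟩
      allB p (range1 m ∷ʳ suc m)
    ≡⟨ allB-∷ʳ p (range1 m) (suc m) ⟩
      (allB p (range1 m) ∧ p (suc m))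
    ≡⟨ cong₂ _∧_ (allB-congAll p q (range1 m) (All-range1 m)
        (λ j h → cong₂ _<ᵇ_ (update-other g (r' , suc m) (r , j) N
        (sameCell-≢row r' r (suc m) j (λ e → ne (sym e))))
        (update-other g (r' , suc m) (r' , j) N (sameCell-≢column r' (suc m) j (λ e → <⇒≢ (s≤s (proj₂ h)) (sym e))))))
                 (trans (cong₂ _<ᵇ_ (update-other g (r' , suc m) (r , suc m) N
                     (sameCell-≢row r' r (suc m) (suc m) (λ e → ne (sym e)))) (update-self g (r' , suc m) N))
                     (<ᵇ-true (b (r , suc m)))) ⟩
      (allB q (range1 m) ∧ true)
    ≡⟨ ∧-identityʳ _ ⟩
      allB q (range1 m) ∎
    where
    open ≡-Reasoning
    p = λ j → update g (r' , suc m) N (r , j) <ᵇ update g (r' , suc m) N (r' , j)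
    q = λ j → g (r , j) <ᵇ g (r' , j)

  -- Where the largest entry of a b_{n,m,k} filling can sit

  valid₃-max-end-row1 : (n m : ℕ) (S : List ℕ) (g : Cell → ℕ) (N : ℕ) → m ≤ n → Below N g →
    valid₃ (suc n) m S (update g (1 , suc n) N) ≡ valid₃ n m S g
  valid₃-max-end-row1 n m S g N m≤n b = cong₂ _∧_ (rowIncreasing-update-end g N 1 n b)
    (cong₂ _∧_ (rowIncreasing-update-elsewhere g (1 , suc n) N 2 m (λ j _ _ → sameCell-≢row 1 2 (suc n) j (λ ())))
    (cong₂ _∧_ (columnIncreasing-update-elsewhere g (1 , suc n) N 1 2 (range1 m)
        (All.map (λ {j} h → sameCell-≢column 1 (suc n) j
        (λ e → <⇒≢ (s≤s (≤-trans (proj₂ h) m≤n)) (sym e)) , sameCell-≢row 1 2 (suc n) j (λ ())) (All-range1 m)))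
               (columnIncreasing-update-elsewhere g (1 , suc n) N 2 3 S
                   (All.universal (λ j → sameCell-≢row 1 2 (suc n) j (λ ()) , sameCell-≢row 1 3 (suc n) j (λ ())) S))))

  valid₃-max-end-row2 : (n m : ℕ) (S : List ℕ) (g : Cell → ℕ) (N : ℕ) → All (λ s → ¬ s ≡ suc m) S → Below N g →
    valid₃ n (suc m) S (update g (2 , suc m) N) ≡ valid₃ n m S g
  valid₃-max-end-row2 n m S g N nS b = cong₂ _∧_
      (rowIncreasing-update-elsewhere g (2 , suc m) N 1 n (λ j _ _ → sameCell-≢row 2 1 (suc m) j (λ ())))
    (cong₂ _∧_ (rowIncreasing-update-end g N 2 m b)
    (cong₂ _∧_ (columnIncreasing-update-end g N 1 2 m (λ ()) b)
               (columnIncreasing-update-elsewhere g (2 , suc m) N 2 3 S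
                   (All.map (λ {s} h → sameCell-≢column 2 (suc m) s (λ e → h (sym e)) , sameCell-≢row 2 3
                   (suc m) s (λ ())) nS))))

  allB-picks : (S : List ℕ) → All (λ sr → ∀ (p : ℕ → Bool) → allB p S ≡ (p (proj₁ sr) ∧ allB p (proj₂ sr))) (picks S)
  allB-picks [] = []
  allB-picks (x ∷ S) = (λ p → refl) ∷ map⁺
      (All.map (λ {sr} e p → trans (cong (p x ∧_) (e p)) (∧-left-comm (p x) (p (proj₁ sr)) (allB p (proj₂ sr))))
      (allB-picks S))

  valid₃-max-row3 : (n m : ℕ) (S : List ℕ) (s : ℕ) (S' : List ℕ) (g : Cell → ℕ) (N : ℕ) →
    (∀ (p : ℕ → Bool) → allB p S ≡ (p s ∧ allB p S')) →
    All (λ t → ¬ s ≡ t) S' → Below N g →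
    valid₃ n m S (update g (3 , s) N) ≡ valid₃ n m S' g
  valid₃-max-row3 n m S s S' g N dec nS b = cong₂ _∧_
      (rowIncreasing-update-elsewhere g (3 , s) N 1 n (λ j _ _ → sameCell-≢row 3 1 s j (λ ())))
    (cong₂ _∧_ (rowIncreasing-update-elsewhere g (3 , s) N 2 m (λ j _ _ → sameCell-≢row 3 2 s j (λ ())))
    (cong₂ _∧_ (columnIncreasing-update-elsewhere g (3 , s) N 1 2 (range1 m)
        (All.map (λ {j} _ → sameCell-≢row 3 1 s j (λ ()) , sameCell-≢row 3 2 s j (λ ())) (All-range1 m)))
      (trans (dec (λ j → update g (3 , s) N (2 , j) <ᵇ update g (3 , s) N (3 , j)))
          (cong₂ _∧_ (trans (cong₂ _<ᵇ_ (update-other g (3 , s) (2 , s) N (sameCell-≢row 3 2 s s (λ ())))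
          (update-self g (3 , s) N)) (<ᵇ-true (b (2 , s))))
         (columnIncreasing-update-elsewhere g (3 , s) N 2 3 S'
             (All.map (λ {t} h → sameCell-≢row 3 2 s t (λ ()) , sameCell-≢column 3 s t h) nS))))))

  <⇒≤∸1 : ∀ n j → j < n → j ≤ n ∸ 1
  <⇒≤∸1 (suc n) j (s≤s p) = p

  valid₃-max-inside-row1 : (n m : ℕ) (S : List ℕ) (g : Cell → ℕ) (N j : ℕ) → 1 ≤ j → j < n → Below N g
      → valid₃ n m S (update g (1 , j) N) ≡ false
  valid₃-max-inside-row1 n m S g N j a j<n b = cong (_∧ _)
      (allB-range1-false (λ i → update g (1 , j) N (1 , i) <ᵇ update g (1 , j) N (1 , suc i)) (n ∸ 1) j a (<⇒≤∸1 n j j<n)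
    (trans (cong₂ _<ᵇ_ (update-self g (1 , j) N)
        (update-other g (1 , j) (1 , suc j) N (sameCell-≢column 1 j (suc j) (λ e → <⇒≢ ≤-refl e))))
        (<ᵇ-false (<⇒≤ (b (1 , suc j))))))

  valid₃-max-below-row2 : (n m : ℕ) (S : List ℕ) (g : Cell → ℕ) (N : ℕ) → 1 ≤ n → n ≤ m → Below N g
      → valid₃ n m S (update g (1 , n) N) ≡ false
  valid₃-max-below-row2 n m S g N a n≤m b rewrite allB-range1-false
      (λ i → update g (1 , n) N (1 , i) <ᵇ update g (1 , n) N (2 , i)) m n a n≤m
    (trans (cong₂ _<ᵇ_ (update-self g (1 , n) N)
        (update-other g (1 , n) (2 , n) N (sameCell-≢row 1 2 n n (λ ())))) (<ᵇ-false (<⇒≤ (b (2 , n))))) =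
    trans (cong (rowIncreasing (update g (1 , n) N) 1 n ∧_) (∧-zeroʳ _)) (∧-zeroʳ _)

  valid₃-max-inside-row2 : (n m : ℕ) (S : List ℕ) (g : Cell → ℕ) (N j : ℕ) → 1 ≤ j → j < m → Below N g
      → valid₃ n m S (update g (2 , j) N) ≡ false
  valid₃-max-inside-row2 n m S g N j a j<m b = trans
      (cong (λ z → rowIncreasing (update g (2 , j) N) 1 n ∧
      (z ∧ (columnIncreasing (update g (2 , j) N) 1 2 (range1 m)
      ∧ columnIncreasing (update g (2 , j) N) 2 3 S)))
      (allB-range1-false (λ i → update g (2 , j) N (2 , i) <ᵇ update g (2 , j) N (2 , suc i)) (m ∸ 1) j a (<⇒≤∸1 m j j<m)
    (trans (cong₂ _<ᵇ_ (update-self g (2 , j) N)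
        (update-other g (2 , j) (2 , suc j) N (sameCell-≢column 2 j (suc j) (λ e → <⇒≢ ≤-refl e))))
        (<ᵇ-false (<⇒≤ (b (2 , suc j))))))) (∧-zeroʳ (rowIncreasing (update g (2 , j) N) 1 n))

  valid₃-max-below-row3 : (n m : ℕ) (S : List ℕ) (s : ℕ) (g : Cell → ℕ) (N : ℕ) → Below N g
      → valid₃ n m (S ∷ʳ s) (update g (2 , s) N) ≡ false
  valid₃-max-below-row3 n m S s g N b rewrite allB-∷ʳ
      (λ i → update g (2 , s) N (2 , i) <ᵇ update g (2 , s) N (3 , i)) S s
    | update-self g (2 , s) N | update-other g (2 , s) (3 , s) N (sameCell-≢row 2 3 s s (λ ())) | <ᵇ-false
        (<⇒≤ (b (3 , s))) = absorb (rowIncreasing (update g (2 , s) N) 1 n)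
        (rowIncreasing (update g (2 , s) N) 2 m) (columnIncreasing (update g (2 , s) N) 1 2 (range1 m))
        (allB (λ i → update g (2 , s) N (2 , i) <ᵇ update g (2 , s) N (3 , i)) S)
    where
    absorb : ∀ a b c d → (a ∧ (b ∧ (c ∧ (d ∧ false)))) ≡ false
    absorb true true true true = refl
    absorb true true true false = refl
    absorb true true false d = refl
    absorb true false c d = refl
    absorb false b c d = refl

  sumBy-picks-++ : (f : A × List A → ℕ) (xs ys : List A) →
    sumBy f (picks (xs ++ ys)) ≡ sumBy (λ cr → f (proj₁ cr , proj₂ cr ++ ys)) (picks xs)
        + sumBy (λ cr → f (proj₁ cr , xs ++ proj₂ cr)) (picks ys)
  sumBy-picks-++ f [] ys = refl
  sumBy-picks-++ f (x ∷ xs) ys = begin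
      f (x , xs ++ ys) + sumBy f (map (λ cr → (proj₁ cr , x ∷ proj₂ cr)) (picks (xs ++ ys)))
    ≡⟨ cong (f (x , xs ++ ys) +_) (trans (sumBy-map f _ (picks (xs ++ ys)))
        (sumBy-picks-++ (λ cr → f (proj₁ cr , x ∷ proj₂ cr)) xs ys)) ⟩
      f (x , xs ++ ys) + (sumBy (λ cr → f (proj₁ cr , x ∷ proj₂ cr ++ ys)) (picks xs)
          + sumBy (λ cr → f (proj₁ cr , x ∷ xs ++ proj₂ cr)) (picks ys))
    ≡⟨ sym (+-assoc (f (x , xs ++ ys)) _ _) ⟩
      f (x , xs ++ ys) + sumBy (λ cr → f (proj₁ cr , x ∷ proj₂ cr ++ ys)) (picks xs)
          + sumBy (λ cr → f (proj₁ cr , x ∷ xs ++ proj₂ cr)) (picks ys)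
    ≡⟨ cong (λ z → f (x , xs ++ ys) + z + sumBy (λ cr → f (proj₁ cr , x ∷ xs ++ proj₂ cr)) (picks ys))
        (sym (sumBy-map (λ cr → f (proj₁ cr , proj₂ cr ++ ys)) (λ cr → (proj₁ cr , x ∷ proj₂ cr)) (picks xs))) ⟩
      f (x , xs ++ ys) + sumBy (λ cr → f (proj₁ cr , proj₂ cr ++ ys))
          (map (λ cr → (proj₁ cr , x ∷ proj₂ cr)) (picks xs))
          + sumBy (λ cr → f (proj₁ cr , x ∷ xs ++ proj₂ cr)) (picks ys) ∎
    where open ≡-Reasoning

  sumBy-picks-map : (f : A′ × List A′ → ℕ) (h : A → A′) (xs : List A) →
    sumBy f (picks (map h xs)) ≡ sumBy (λ cr → f (h (proj₁ cr) , map h (proj₂ cr))) (picks xs)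
  sumBy-picks-map f h [] = refl
  sumBy-picks-map f h (x ∷ xs) = cong (f (h x , map h xs) +_) (trans (sumBy-map f _ (picks (map h xs)))
    (trans (sumBy-picks-map (λ cr → f (proj₁ cr , h x ∷ proj₂ cr)) h xs)
        (sym (sumBy-map _ (λ cr → (proj₁ cr , x ∷ proj₂ cr)) (picks xs)))))

  sumBy-picks-∷ʳ : (f : A × List A → ℕ) (xs : List A) (y : A) →
    sumBy f (picks (xs ∷ʳ y)) ≡ sumBy (λ cr → f (proj₁ cr , proj₂ cr ∷ʳ y)) (picks xs) + f (y , xs)
  sumBy-picks-∷ʳ f xs y = trans (sumBy-picks-++ f xs (y ∷ []))
      (cong (sumBy (λ cr → f (proj₁ cr , proj₂ cr ∷ʳ y)) (picks xs) +_)
      (trans (+-identityʳ _) (cong (λ z → f (y , z)) (++-identityʳ xs))))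

  All-picks : (Q : A → Set) (xs : List A) → All Q xs → All (λ cr → Q (proj₁ cr) × All Q (proj₂ cr)) (picks xs)
  All-picks Q [] [] = []
  All-picks Q (x ∷ xs) (q ∷ qs) = (q , qs) ∷ map⁺ (All.map (λ {cr} h → proj₁ h , (q ∷ proj₂ h)) (All-picks Q xs qs))

  picks-distinct : (cs : List Cell) → Distinct cs →
    All (λ cr → Fresh (proj₁ cr) (proj₂ cr) × Distinct (proj₂ cr)) (picks cs)
  picks-distinct [] d = []
  picks-distinct (x ∷ xs) (nx , d) = (nx , d) ∷ map⁺ (All.zipWith (λ {cr} ((fr , dr) , (xc , xr)) →
      (trans (sameCell-sym (proj₁ cr) x) xc ∷ fr) , (xr , dr))
    (picks-distinct xs d , All-picks (λ y → sameCell x y ≡ false) xs nx))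

  rowIncreasing-cong : (g h : Cell → ℕ) (r len : ℕ) → (∀ x → g x ≡ h x) → rowIncreasing g r len ≡ rowIncreasing h r len
  rowIncreasing-cong g h r len e = allB-cong (λ j → g (r , j) <ᵇ g (r , suc j))
      (λ j → h (r , j) <ᵇ h (r , suc j)) (range1 (len ∸ 1)) (λ j → cong₂ _<ᵇ_ (e (r , j)) (e (r , suc j)))

  columnIncreasing-cong : (g h : Cell → ℕ) (r r' : ℕ) (js : List ℕ) → (∀ x → g x ≡ h x)
      → columnIncreasing g r r' js ≡ columnIncreasing h r r' js
  columnIncreasing-cong g h r r' js e = allB-cong (λ j → g (r , j) <ᵇ g (r' , j))
      (λ j → h (r , j) <ᵇ h (r' , j)) js (λ j → cong₂ _<ᵇ_ (e (r , j)) (e (r' , j)))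

  valid₃-cong : (n m : ℕ) (S : List ℕ) (g h : Cell → ℕ) → (∀ x → g x ≡ h x) → valid₃ n m S g ≡ valid₃ n m S h
  valid₃-cong n m S g h e = cong₂ _∧_ (rowIncreasing-cong g h 1 n e)
      (cong₂ _∧_ (rowIncreasing-cong g h 2 m e)
      (cong₂ _∧_ (columnIncreasing-cong g h 1 2 (range1 m) e) (columnIncreasing-cong g h 2 3 S e)))

  countByCells-∷ʳ-max : (n m : ℕ) (S : List ℕ) (c : Cell) (r : List Cell) → Fresh c r → (Q : (Cell → ℕ) → Bool) →
    (∀ g → Below (suc (length r)) g → valid₃ n m S (update g c (suc (length r))) ≡ Q g) →
    countByCells r (λ T → valid₃ n m S (val (T ∷ʳ (c , suc (length r))))) ≡ countByCells r (λ T → Q (val T))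
  countByCells-∷ʳ-max n m S c r ni Q H = countByCells-congAll (λ x → sameCell c x ≡ false) r ni
      (λ T → valid₃ n m S (val (T ∷ʳ (c , suc (length r))))) (λ T → Q (val T))
    (λ σ nσ lσ → trans (valid₃-cong n m S (val (zip σ (range1 (length r)) ∷ʳ (c , suc (length r))))
        (update (val (zip σ (range1 (length r)))) c (suc (length r)))
        (val-∷ʳ≗update σ (range1 (length r)) c (suc (length r)) nσ))
       (H (val (zip σ (range1 (length r)))) (λ x → s≤s (val-range1-≤ σ (length r) x))))

  Increasing : List ℕ → Set
  Increasing [] = ⊤
  Increasing (x ∷ xs) = All (x <_) xs × Increasing xs

  Increasing-applyUpTo : (f : ℕ → ℕ) → (∀ i j → i < j → f i < f j) → ∀ n → Increasing (applyUpTo f n)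
  Increasing-applyUpTo f mono zero = tt
  Increasing-applyUpTo f mono (suc n) = applyUpTo⁺₂ (f ∘ suc) n
      (λ i → mono 0 (suc i) (s≤s z≤n)) , Increasing-applyUpTo (f ∘ suc) (λ i j p → mono (suc i) (suc j) (s≤s p)) n

  Increasing-range1 : ∀ n → Increasing (range1 n)
  Increasing-range1 = Increasing-applyUpTo suc (λ i j p → s≤s p)

  Distinct-row : (r : ℕ) (L : List ℕ) → Increasing L → Distinct (map (r ,_) L)
  Distinct-row r [] i = tt
  Distinct-row r (x ∷ L) (a , i) = map⁺ (All.map (λ {y} p → sameCell-≢column r x y (<⇒≢ p)) a) , Distinct-row r L i

  Fresh-otherRow : (r r' : ℕ) → ¬ r ≡ r' → (x : ℕ) (L : List ℕ) → Fresh (r , x) (map (r' ,_) L)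
  Fresh-otherRow r r' ne x L = map⁺ (All.universal (λ y → sameCell-≢row r r' x y ne) L)

  Distinct-++ : (xs ys : List Cell) → Distinct xs → Distinct ys → All (λ x → Fresh x ys) xs → Distinct (xs ++ ys)
  Distinct-++ [] ys dx dy a = dy
  Distinct-++ (x ∷ xs) ys (nx , dx) dy (ax ∷ a) = ++⁺ nx ax , Distinct-++ xs ys dx dy a

  shapeB3-distinct : (n m : ℕ) (S : List ℕ) → Increasing S → Distinct (shapeB3 n m S)
  shapeB3-distinct n m S iS = Distinct-++ (map (1 ,_) (range1 n)) _ (Distinct-row 1 (range1 n) (Increasing-range1 n))
    (Distinct-++ (map (2 ,_) (range1 m)) _ (Distinct-row 2 (range1 m) (Increasing-range1 m)) (Distinct-row 3 S iS)
       (map⁺ (All.universal (λ j → Fresh-otherRow 2 3 (λ ()) j S) _)))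
    (map⁺ (All.universal (λ j → ++⁺ (Fresh-otherRow 1 2 (λ ()) j (range1 m)) (Fresh-otherRow 1 3 (λ ()) j S)) _))

  -- The recurrence for b_{n,m,k}

  countB3 : ℕ → ℕ → List ℕ → ℕ
  countB3 n m S = countByCells (shapeB3 n m S) (λ T → valid₃ n m S (val T))

  countMaxAt : ℕ → ℕ → List ℕ → Cell × List Cell → ℕ
  countMaxAt n m S cr = countByCells (proj₂ cr)
      (λ T → valid₃ n m S (update (val T) (proj₁ cr) (suc (length (proj₂ cr)))))

  countByCells-cong-below : (r : List Cell) (X Y : (Cell → ℕ) → Bool)
      → (∀ g → Below (suc (length r)) g → X g ≡ Y g) → countByCells r (λ T → X (val T))
      ≡ countByCells r (λ T → Y (val T))
  countByCells-cong-below r X Y h = countByCells-congAll (λ _ → ⊤) r (All.universal (λ _ → tt) r)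
      (λ T → X (val T)) (λ T → Y (val T))
      (λ σ _ _ → h (val (zip σ (range1 (length r)))) (λ x → s≤s (val-range1-≤ σ (length r) x)))

  countByCells-zero-below : (r : List Cell) (X : (Cell → ℕ) → Bool)
      → (∀ g → Below (suc (length r)) g → X g ≡ false) → countByCells r (λ T → X (val T)) ≡ 0
  countByCells-zero-below r X h = trans (countByCells-cong-below r X (λ _ → false) h) (sumBy-zero (permutations r))

  countB3-by-max-cell : (n0 m : ℕ) (S : List ℕ) → Increasing S → countB3 (suc n0) m S
      ≡ sumBy (countMaxAt (suc n0) m S) (picks (shapeB3 (suc n0) m S))
  countB3-by-max-cell n0 m S iS = trans
      (countByCells-last (1 , 1) (map (1 ,_) (applyUpTo (suc ∘ suc) n0) ++ map (2 ,_) (range1 m) ++ map (3 ,_) S)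
          (λ T → valid₃ (suc n0) m S (val T)))
    (sumBy-congAll (picks (shapeB3 (suc n0) m S))
        (picks-distinct (shapeB3 (suc n0) m S) (shapeB3-distinct (suc n0) m S iS))
      (λ cr h → countByCells-∷ʳ-max (suc n0) m S (proj₁ cr) (proj₂ cr) (proj₁ h)
          (λ g → valid₃ (suc n0) m S (update g (proj₁ cr) (suc (length (proj₂ cr))))) (λ g _ → refl)))

  sumBy-picks-shapeB3 : (n m : ℕ) (S : List ℕ) → sumBy (countMaxAt n m S) (picks (shapeB3 n m S)) ≡
    sumBy (λ cr → countMaxAt n m S (proj₁ cr , proj₂ cr ++ (map (2 ,_) (range1 m) ++ map (3 ,_) S)))
        (picks (map (1 ,_) (range1 n)))
    + (sumBy (λ cr → countMaxAt n m S (proj₁ cr , map (1 ,_) (range1 n) ++ (proj₂ cr ++ map (3 ,_) S)))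
        (picks (map (2 ,_) (range1 m)))
    + sumBy (λ cr → countMaxAt n m S (proj₁ cr , map (1 ,_) (range1 n) ++
        (map (2 ,_) (range1 m) ++ proj₂ cr))) (picks (map (3 ,_) S)))
  sumBy-picks-shapeB3 n m S = trans (sumBy-picks-++ (countMaxAt n m S) (map (1 ,_) (range1 n))
      (map (2 ,_) (range1 m) ++ map (3 ,_) S))
    (cong (sumBy (λ cr → countMaxAt n m S (proj₁ cr , proj₂ cr ++ (map (2 ,_) (range1 m) ++ map (3 ,_) S)))
        (picks (map (1 ,_) (range1 n))) +_)
      (sumBy-picks-++ (λ cr → countMaxAt n m S (proj₁ cr , map (1 ,_) (range1 n) ++ proj₂ cr))
          (map (2 ,_) (range1 m)) (map (3 ,_) S)))

  maxInRow1 : (n0 m : ℕ) (S : List ℕ) →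
    sumBy (λ cr → countMaxAt (suc n0) m S (proj₁ cr , proj₂ cr ++ (map (2 ,_) (range1 m) ++ map (3 ,_) S)))
        (picks (map (1 ,_) (range1 (suc n0))))
    ≡ countMaxAt (suc n0) m S ((1 , suc n0) , shapeB3 n0 m S)
  maxInRow1 n0 m S = begin
      sumBy (λ cr → countMaxAt (suc n0) m S (proj₁ cr , proj₂ cr ++ rows23)) (picks (map (1 ,_) (range1 (suc n0))))
    ≡⟨ sumBy-picks-map (λ cr → countMaxAt (suc n0) m S (proj₁ cr , proj₂ cr ++ rows23)) (1 ,_) (range1 (suc n0)) ⟩
      sumBy maxAt (picks (range1 (suc n0)))
    ≡⟨ cong (λ z → sumBy maxAt (picks z)) (range1-suc n0) ⟩
      sumBy maxAt (picks (range1 n0 ∷ʳ suc n0))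
    ≡⟨ sumBy-picks-∷ʳ maxAt (range1 n0) (suc n0) ⟩
      sumBy (λ cr → maxAt (proj₁ cr , proj₂ cr ∷ʳ suc n0)) (picks (range1 n0)) + maxAt (suc n0 , range1 n0)
    ≡⟨ cong (_+ maxAt (suc n0 , range1 n0))
        (trans (sumBy-congAll (picks (range1 n0)) (All-picks _ (range1 n0) (All-range1 n0))
          (λ cr h → countByCells-zero-below (map (1 ,_) (proj₂ cr ∷ʳ suc n0) ++ rows23) _
              (λ g b → valid₃-max-inside-row1 (suc n0) m S g _ (proj₁ cr) (proj₁ (proj₁ h))
              (s≤s (proj₂ (proj₁ h))) b))) (sumBy-zero (picks (range1 n0)))) ⟩
      maxAt (suc n0 , range1 n0) ∎
    where
    open ≡-Reasoning
    rows23 = map (2 ,_) (range1 m) ++ map (3 ,_) S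
    maxAt = λ (cr : ℕ × List ℕ) → countMaxAt (suc n0) m S ((1 , proj₁ cr) , map (1 ,_) (proj₂ cr) ++ rows23)

  maxInRow2 : (n m0 : ℕ) (S : List ℕ) →
    sumBy (λ cr → countMaxAt n (suc m0) S (proj₁ cr , map (1 ,_) (range1 n) ++ (proj₂ cr ++ map (3 ,_) S)))
        (picks (map (2 ,_) (range1 (suc m0))))
    ≡ countMaxAt n (suc m0) S ((2 , suc m0) , shapeB3 n m0 S)
  maxInRow2 n m0 S = begin
      sumBy (λ cr → countMaxAt n (suc m0) S (proj₁ cr , row1 ++ (proj₂ cr ++ row3)))
          (picks (map (2 ,_) (range1 (suc m0))))
    ≡⟨ sumBy-picks-map (λ cr → countMaxAt n (suc m0) S (proj₁ cr , row1 ++ (proj₂ cr ++ row3))) (2 ,_)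
        (range1 (suc m0)) ⟩
      sumBy maxAt (picks (range1 (suc m0)))
    ≡⟨ cong (λ z → sumBy maxAt (picks z)) (range1-suc m0) ⟩
      sumBy maxAt (picks (range1 m0 ∷ʳ suc m0))
    ≡⟨ sumBy-picks-∷ʳ maxAt (range1 m0) (suc m0) ⟩
      sumBy (λ cr → maxAt (proj₁ cr , proj₂ cr ∷ʳ suc m0)) (picks (range1 m0)) + maxAt (suc m0 , range1 m0)
    ≡⟨ cong (_+ maxAt (suc m0 , range1 m0))
        (trans (sumBy-congAll (picks (range1 m0)) (All-picks _ (range1 m0) (All-range1 m0))
          (λ cr h → countByCells-zero-below (row1 ++ (map (2 ,_) (proj₂ cr ∷ʳ suc m0) ++ row3)) _
              (λ g b → valid₃-max-inside-row2 n (suc m0) S g _ (proj₁ cr) (proj₁ (proj₁ h))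
              (s≤s (proj₂ (proj₁ h))) b))) (sumBy-zero (picks (range1 m0)))) ⟩
      maxAt (suc m0 , range1 m0) ∎
    where
    open ≡-Reasoning
    row1 = map (1 ,_) (range1 n)
    row3 = map (3 ,_) S
    maxAt = λ (cr : ℕ × List ℕ) → countMaxAt n (suc m0) S ((2 , proj₁ cr) , row1 ++ (map (2 ,_) (proj₂ cr) ++ row3))

  picks-increasing : (S : List ℕ) → Increasing S → All (λ sr → All (λ t → ¬ proj₁ sr ≡ t) (proj₂ sr)) (picks S)
  picks-increasing [] _ = []
  picks-increasing (x ∷ S) (a , iS) = All.map (λ {t} p → <⇒≢ p) a ∷ map⁺
      (All.zipWith (λ ((x<s , _) , s∉) → (λ e → <⇒≢ x<s (sym e)) ∷ s∉)
    (All-picks (x <_) S a , picks-increasing S iS))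

  maxInRow3 : (n m : ℕ) (S : List ℕ) → Increasing S →
    sumBy (λ cr → countMaxAt n m S (proj₁ cr , map (1 ,_) (range1 n) ++ (map (2 ,_) (range1 m) ++ proj₂ cr)))
        (picks (map (3 ,_) S))
    ≡ sumBy (λ sr → countB3 n m (proj₂ sr)) (picks S)
  maxInRow3 n m S iS = trans (sumBy-picks-map
      (λ cr → countMaxAt n m S (proj₁ cr , map (1 ,_) (range1 n) ++ (map (2 ,_) (range1 m) ++ proj₂ cr))) (3 ,_) S)
    (sumBy-congAll (picks S) (All.zip (allB-picks S , picks-increasing S iS))
      (λ sr h → countByCells-cong-below (shapeB3 n m (proj₂ sr)) _ _
          (λ g b → valid₃-max-row3 n m S (proj₁ sr) (proj₂ sr) g _ (proj₁ h) (proj₂ h) b)))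

  countMaxAt-row1-end : (n0 m : ℕ) (S : List ℕ) → m ≤ n0 → countMaxAt (suc n0) m S
      ((1 , suc n0) , shapeB3 n0 m S) ≡ countB3 n0 m S
  countMaxAt-row1-end n0 m S le = countByCells-cong-below (shapeB3 n0 m S) _ _
      (λ g b → valid₃-max-end-row1 n0 m S g _ le b)

  countMaxAt-row1-end-blocked : (n0 : ℕ) (S : List ℕ) → countMaxAt (suc n0) (suc n0) S
      ((1 , suc n0) , shapeB3 n0 (suc n0) S) ≡ 0
  countMaxAt-row1-end-blocked n0 S = countByCells-zero-below (shapeB3 n0 (suc n0) S) _
      (λ g b → valid₃-max-below-row2 (suc n0) (suc n0) S g _ (s≤s z≤n) ≤-refl b)

  countMaxAt-row2-end : (n m0 : ℕ) (S : List ℕ) → All (λ s → ¬ s ≡ suc m0) S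
      → countMaxAt n (suc m0) S ((2 , suc m0) , shapeB3 n m0 S) ≡ countB3 n m0 S
  countMaxAt-row2-end n m0 S nS = countByCells-cong-below (shapeB3 n m0 S) _ _
      (λ g b → valid₃-max-end-row2 n m0 S g _ nS b)

  countMaxAt-row2-end-blocked : (n m0 : ℕ) (S : List ℕ) → countMaxAt n (suc m0) (S ∷ʳ suc m0)
      ((2 , suc m0) , shapeB3 n m0 (S ∷ʳ suc m0)) ≡ 0
  countMaxAt-row2-end-blocked n m0 S = countByCells-zero-below (shapeB3 n m0 (S ∷ʳ suc m0)) _
      (λ g b → valid₃-max-below-row3 n (suc m0) S (suc m0) g _ b)

  countMaxAtRow2End : ℕ → ℕ → List ℕ → ℕ
  countMaxAtRow2End n zero S = 0
  countMaxAtRow2End n (suc m0) S = countMaxAt n (suc m0) S ((2 , suc m0) , shapeB3 n m0 S)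

  countB3-recurrence : (n0 m : ℕ) (S : List ℕ) → Increasing S →
    countB3 (suc n0) m S ≡ countMaxAt (suc n0) m S ((1 , suc n0) , shapeB3 n0 m S)
        + (countMaxAtRow2End (suc n0) m S + sumBy (λ sr → countB3 (suc n0) m (proj₂ sr)) (picks S))
  countB3-recurrence n0 m S iS = trans (countB3-by-max-cell n0 m S iS) (trans (sumBy-picks-shapeB3 (suc n0) m S)
    (cong₂ _+_ (maxInRow1 n0 m S) (cong₂ _+_ (row2-part m) (maxInRow3 (suc n0) m S iS))))
    where
    row2-part : ∀ m → sumBy (λ cr → countMaxAt (suc n0) m S
        (proj₁ cr , map (1 ,_) (range1 (suc n0)) ++ (proj₂ cr ++ map (3 ,_) S)))
        (picks (map (2 ,_) (range1 m))) ≡ countMaxAtRow2End (suc n0) m S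
    row2-part zero = refl
    row2-part (suc m0) = maxInRow2 (suc n0) m0 S

  sumℕ-map : (f : A → ℕ) (xs : List A) → sumℕ (map f xs) ≡ sumBy f xs
  sumℕ-map f [] = refl
  sumℕ-map f (x ∷ xs) = cong (f x +_) (sumℕ-map f xs)

  All-choose : {Q : ℕ → Set} (xs : List ℕ) (k : ℕ) → All Q xs → All (All Q) (choose xs k)
  All-choose xs zero a = [] ∷ []
  All-choose [] (suc k) [] = []
  All-choose (x ∷ xs) (suc k) (q ∷ a) = ++⁺ (map⁺ (All.map (λ {S} h → q ∷ h) (All-choose xs k a)))
      (All-choose xs (suc k) a)

  choose-increasing : (xs : List ℕ) (k : ℕ) → Increasing xs → All Increasing (choose xs k)
  choose-increasing xs zero i = tt ∷ []
  choose-increasing [] (suc k) i = []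
  choose-increasing (x ∷ xs) (suc k) (a , i) = ++⁺
      (map⁺ (All.zip (All-choose xs k a , choose-increasing xs k i))) (choose-increasing xs (suc k) i)

  choose-empty : (xs : List ℕ) (k : ℕ) → length xs < k → choose xs k ≡ []
  choose-empty [] (suc k) p = refl
  choose-empty (x ∷ xs) (suc k) (s≤s p) rewrite choose-empty xs k p | choose-empty xs (suc k) (m≤n⇒m≤1+n p) = refl

  RespectsVal-valid₃ : (n m : ℕ) (S : List ℕ) → RespectsVal (λ T → valid₃ n m S (val T))
  RespectsVal-valid₃ n m S T1 T2 e = valid₃-cong n m S (val T1) (val T2) e

  bnmk≡sumBy-countB3 : (n m k : ℕ) → bnmk n m k ≡ sumBy (countB3 n m) (choose (range1 m) k)
  bnmk≡sumBy-countB3 n m k = trans (sumℕ-map _ (choose (range1 m) k))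
      (sumBy-congAll (choose (range1 m) k) (choose-increasing (range1 m) k (Increasing-range1 m))
    (λ S iS → count-fillings (shapeB3 n m S) (shapeB3-distinct n m S iS) (validB3 n m S) (RespectsVal-valid₃ n m S)))

  sumBy-choose-∷ʳ : (f : List ℕ → ℕ) (xs : List ℕ) (y : ℕ) (k : ℕ) →
    sumBy f (choose (xs ∷ʳ y) (suc k)) ≡ sumBy f (choose xs (suc k)) + sumBy (λ S → f (S ∷ʳ y)) (choose xs k)
  sumBy-choose-∷ʳ f [] y zero = refl
  sumBy-choose-∷ʳ f [] y (suc k) = refl
  sumBy-choose-∷ʳ f (x ∷ xs) y zero = begin
      sumBy f (map (x ∷_) (choose (xs ∷ʳ y) 0) ++ choose (xs ∷ʳ y) 1)
    ≡⟨ sumBy-++ f (map (x ∷_) (choose (xs ∷ʳ y) 0)) (choose (xs ∷ʳ y) 1) ⟩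
      f (x ∷ []) + 0 + sumBy f (choose (xs ∷ʳ y) 1)
    ≡⟨ cong (f (x ∷ []) + 0 +_) (sumBy-choose-∷ʳ f xs y 0) ⟩
      f (x ∷ []) + 0 + (sumBy f (choose xs 1) + (f (y ∷ []) + 0))
    ≡⟨ sym (+-assoc (f (x ∷ []) + 0) _ _) ⟩
      f (x ∷ []) + 0 + sumBy f (choose xs 1) + (f (y ∷ []) + 0)
    ≡⟨ cong (_+ (f (y ∷ []) + 0)) (sym (sumBy-++ f (map (x ∷_) (choose xs 0)) (choose xs 1))) ⟩
      sumBy f (map (x ∷_) (choose xs 0) ++ choose xs 1) + (f (y ∷ []) + 0) ∎
    where open ≡-Reasoning
  sumBy-choose-∷ʳ f (x ∷ xs) y (suc k) = begin
      sumBy f (map (x ∷_) (choose (xs ∷ʳ y) (suc k)) ++ choose (xs ∷ʳ y) (suc (suc k)))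
    ≡⟨ sumBy-++ f (map (x ∷_) (choose (xs ∷ʳ y) (suc k))) (choose (xs ∷ʳ y) (suc (suc k))) ⟩
      sumBy f (map (x ∷_) (choose (xs ∷ʳ y) (suc k))) + sumBy f (choose (xs ∷ʳ y) (suc (suc k)))
    ≡⟨ cong₂ _+_ (trans (sumBy-map f (x ∷_) (choose (xs ∷ʳ y) (suc k))) (sumBy-choose-∷ʳ (f ∘ (x ∷_)) xs y k))
        (sumBy-choose-∷ʳ f xs y (suc k)) ⟩
      (sumBy (f ∘ (x ∷_)) (choose xs (suc k)) + sumBy (λ S → f (x ∷ (S ∷ʳ y))) (choose xs k))
          + (sumBy f (choose xs (suc (suc k))) + sumBy (λ S → f (S ∷ʳ y)) (choose xs (suc k)))
    ≡⟨ +-interchange (sumBy (f ∘ (x ∷_)) (choose xs (suc k))) (sumBy (λ S → f (x ∷ (S ∷ʳ y))) (choose xs k))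
        (sumBy f (choose xs (suc (suc k)))) (sumBy (λ S → f (S ∷ʳ y)) (choose xs (suc k))) ⟩
      (sumBy (f ∘ (x ∷_)) (choose xs (suc k)) + sumBy f (choose xs (suc (suc k))))
          + (sumBy (λ S → f (x ∷ (S ∷ʳ y))) (choose xs k) + sumBy (λ S → f (S ∷ʳ y)) (choose xs (suc k)))
    ≡⟨ cong₂ _+_ (cong (_+ sumBy f (choose xs (suc (suc k)))) (sym (sumBy-map f (x ∷_) (choose xs (suc k)))))
          (cong (_+ sumBy (λ S → f (S ∷ʳ y)) (choose xs (suc k)))
              (sym (sumBy-map (λ S → f (S ∷ʳ y)) (x ∷_) (choose xs k)))) ⟩
      (sumBy f (map (x ∷_) (choose xs (suc k))) + sumBy f (choose xs (suc (suc k))))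
          + (sumBy (λ S → f (S ∷ʳ y)) (map (x ∷_) (choose xs k)) + sumBy (λ S → f (S ∷ʳ y)) (choose xs (suc k)))
    ≡⟨ cong₂ _+_ (sym (sumBy-++ f (map (x ∷_) (choose xs (suc k))) _))
        (sym (sumBy-++ (λ S → f (S ∷ʳ y)) (map (x ∷_) (choose xs k)) _)) ⟩
      sumBy f (choose (x ∷ xs) (suc (suc k))) + sumBy (λ S → f (S ∷ʳ y)) (choose (x ∷ xs) (suc k)) ∎
    where open ≡-Reasoning

  -- Double counting: every k-subset T of xs arises from |xs| - k of the (k+1)-subsets S.
  sumBy-choose-picks : (g : List ℕ → ℕ) (xs : List ℕ) (k : ℕ) →
    sumBy (λ S → sumBy (λ sr → g (proj₂ sr)) (picks S)) (choose xs (suc k)) ≡ (length xs ∸ k) * sumBy g (choose xs k)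
  sumBy-choose-picks g [] zero = refl
  sumBy-choose-picks g [] (suc k) = refl
  sumBy-choose-picks g (x ∷ xs) k = begin
      sumBy sumOverPicks (map (x ∷_) (choose xs k) ++ choose xs (suc k))
    ≡⟨ sumBy-++ sumOverPicks (map (x ∷_) (choose xs k)) _ ⟩
      sumBy sumOverPicks (map (x ∷_) (choose xs k)) + sumBy sumOverPicks (choose xs (suc k))
    ≡⟨ cong₂ _+_ (trans (sumBy-map sumOverPicks (x ∷_) (choose xs k))
        (trans (sumBy-cong (choose xs k) (λ T → cong (g T +_) (sumBy-map (λ sr → g (proj₂ sr)) _ (picks T))))
        (sumBy-+ g _ (choose xs k)))) (sumBy-choose-picks g xs k) ⟩
      sumBy g (choose xs k) + sumBy (λ T → sumBy (λ sr → g (x ∷ proj₂ sr)) (picks T)) (choose xs k)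
          + (length xs ∸ k) * sumBy g (choose xs k)
    ≡⟨ step k ⟩
      (length (x ∷ xs) ∸ k) * sumBy g (choose (x ∷ xs) k) ∎
    where
    open ≡-Reasoning
    sumOverPicks = λ S → sumBy (λ sr → g (proj₂ sr)) (picks S)
    step : ∀ k → sumBy g (choose xs k) + sumBy (λ T → sumBy (λ sr → g (x ∷ proj₂ sr)) (picks T)) (choose xs k)
        + (length xs ∸ k) * sumBy g (choose xs k) ≡ (length (x ∷ xs) ∸ k) * sumBy g (choose (x ∷ xs) k)
    step zero = drop0 (g [])
      where drop0 : ∀ a → a + 0 + 0 + length xs * (a + 0) ≡ (a + 0) + length xs * (a + 0)
            drop0 a = cong (_+ length xs * (a + 0)) (+-identityʳ (a + 0))
    step (suc k') = begin
        withoutX + sumBy (λ T → sumBy (λ sr → g (x ∷ proj₂ sr)) (picks T)) (choose xs (suc k')) + (length xs ∸ suc k') * withoutX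
      ≡⟨ cong (λ z → withoutX + z + (length xs ∸ suc k') * withoutX) (sumBy-choose-picks (g ∘ (x ∷_)) xs k') ⟩
        withoutX + (length xs ∸ k') * withX + (length xs ∸ suc k') * withoutX
      ≡⟨ byCases (<-≤-connex k' (length xs)) ⟩
        (length xs ∸ k') * (withX + withoutX)
      ≡⟨ cong ((length xs ∸ k') *_) (trans (cong (_+ withoutX) (sym (sumBy-map g (x ∷_) (choose xs k'))))
          (sym (sumBy-++ g (map (x ∷_) (choose xs k')) (choose xs (suc k'))))) ⟩
        (length xs ∸ k') * sumBy g (map (x ∷_) (choose xs k') ++ choose xs (suc k')) ∎
      where
      withX = sumBy (g ∘ (x ∷_)) (choose xs k')
      withoutX = sumBy g (choose xs (suc k'))
      byCases : (k' < length xs) ⊎ (length xs ≤ k') → withoutX + (length xs ∸ k') * withX + (length xs ∸ suc k') * withoutX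
          ≡ (length xs ∸ k') * (withX + withoutX)
      byCases (inj₁ lt) rewrite +-∸-assoc 1 lt = regroup withX withoutX (length xs ∸ suc k')
        where regroup : ∀ a b d → b + (1 + d) * a + d * b ≡ (1 + d) * (a + b)
              regroup = solve-∀
      byCases (inj₂ ge) rewrite m≤n⇒m∸n≡0 ge | m≤n⇒m∸n≡0 (m≤n⇒m≤1+n ge) | choose-empty xs (suc k') (s≤s ge) = refl

  dropRow1 : ℕ → ℕ → ℕ → ℕ
  dropRow1 n0 m k = if m ≤ᵇ n0 then bnmk n0 m k else 0

  dropRow2 : ℕ → ℕ → ℕ → ℕ
  dropRow2 n zero k = 0
  dropRow2 n (suc m0) k = bnmk n m0 k

  dropRow3 : ℕ → ℕ → ℕ → ℕ
  dropRow3 n m zero = 0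
  dropRow3 n m (suc k) = (m ∸ k) * bnmk n m k

  ≤ᵇ-true : ∀ {m n} → m ≤ n → (m ≤ᵇ n) ≡ true
  ≤ᵇ-true {zero} p = refl
  ≤ᵇ-true {suc m} {suc n} (s≤s p) = <ᵇ-true (s≤s p)

  ≤ᵇ-false : ∀ {m n} → n < m → (m ≤ᵇ n) ≡ false
  ≤ᵇ-false {suc m} {n} (s≤s p) = <ᵇ-false p

  sumBy-maxInRow1-blocked : (n0 k : ℕ) →
    sumBy (λ S → countMaxAt (suc n0) (suc n0) S ((1 , suc n0) , shapeB3 n0 (suc n0) S)) (choose (range1 (suc n0)) k) ≡ 0
  sumBy-maxInRow1-blocked n0 k = trans
      (sumBy-cong (choose (range1 (suc n0)) k) (λ S → countMaxAt-row1-end-blocked n0 S))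
      (sumBy-zero (choose (range1 (suc n0)) k))

  sumBy-maxInRow1 : (n0 m k : ℕ) → m ≤ suc n0 →
    sumBy (λ S → countMaxAt (suc n0) m S ((1 , suc n0) , shapeB3 n0 m S)) (choose (range1 m) k) ≡ dropRow1 n0 m k
  sumBy-maxInRow1 n0 m k h with ≤-<-connex m n0
  ... | inj₁ le rewrite ≤ᵇ-true le = trans
      (sumBy-cong (choose (range1 m) k) (λ S → countMaxAt-row1-end n0 m S le)) (sym (bnmk≡sumBy-countB3 n0 m k))
  ... | inj₂ gt rewrite ≤ᵇ-false gt | ≤-antisym h gt = sumBy-maxInRow1-blocked n0 k

  sumBy-maxInRow2 : (n m k : ℕ) → sumBy (countMaxAtRow2End n m) (choose (range1 m) k) ≡ dropRow2 n m k
  sumBy-maxInRow2 n zero k = sumBy-zero (choose [] k)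
  sumBy-maxInRow2 n (suc m0) zero = trans (cong (_+ 0) (countMaxAt-row2-end n m0 [] []))
      (sym (bnmk≡sumBy-countB3 n m0 0))
  sumBy-maxInRow2 n (suc m0) (suc k) = begin
      sumBy (countMaxAtRow2End n (suc m0)) (choose (range1 (suc m0)) (suc k))
    ≡⟨ cong (λ z → sumBy (countMaxAtRow2End n (suc m0)) (choose z (suc k))) (range1-suc m0) ⟩
      sumBy (countMaxAtRow2End n (suc m0)) (choose (range1 m0 ∷ʳ suc m0) (suc k))
    ≡⟨ sumBy-choose-∷ʳ (countMaxAtRow2End n (suc m0)) (range1 m0) (suc m0) k ⟩
      sumBy (countMaxAtRow2End n (suc m0)) (choose (range1 m0) (suc k))
          + sumBy (λ S → countMaxAtRow2End n (suc m0) (S ∷ʳ suc m0)) (choose (range1 m0) k)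
    ≡⟨ cong₂ _+_ (sumBy-congAll (choose (range1 m0) (suc k)) (All-choose (range1 m0) (suc k) (All-range1 m0))
        (λ S a → countMaxAt-row2-end n m0 S (All.map (λ {s} h e → <⇒≢ (s≤s (proj₂ h)) e) a)))
                  (trans (sumBy-cong (choose (range1 m0) k) (λ S → countMaxAt-row2-end-blocked n m0 S))
                      (sumBy-zero (choose (range1 m0) k))) ⟩
      sumBy (countB3 n m0) (choose (range1 m0) (suc k)) + 0
    ≡⟨ trans (+-identityʳ _) (sym (bnmk≡sumBy-countB3 n m0 (suc k))) ⟩
      bnmk n m0 (suc k) ∎
    where open ≡-Reasoning

  sumBy-maxInRow3 : (n m k : ℕ) → sumBy (λ S → sumBy (λ sr → countB3 n m (proj₂ sr)) (picks S))
      (choose (range1 m) k) ≡ dropRow3 n m k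
  sumBy-maxInRow3 n m zero = refl
  sumBy-maxInRow3 n m (suc k) = trans (sumBy-choose-picks (countB3 n m) (range1 m) k)
      (cong₂ (λ a b → (a ∸ k) * b) (length-applyUpTo suc m) (sym (bnmk≡sumBy-countB3 n m k)))

  bnmk-recurrence : (n0 m k : ℕ) → m ≤ suc n0 → bnmk (suc n0) m k ≡ dropRow1 n0 m k
      + (dropRow2 (suc n0) m k + dropRow3 (suc n0) m k)
  bnmk-recurrence n0 m k h = begin
      bnmk (suc n0) m k
    ≡⟨ bnmk≡sumBy-countB3 (suc n0) m k ⟩
      sumBy (countB3 (suc n0) m) (choose (range1 m) k)
    ≡⟨ sumBy-congAll (choose (range1 m) k) (choose-increasing (range1 m) k (Increasing-range1 m))
        (λ S iS → countB3-recurrence n0 m S iS) ⟩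
      sumBy (λ S → atRow1End S + (countMaxAtRow2End (suc n0) m S + atRow3 S)) (choose (range1 m) k)
    ≡⟨ trans (sumBy-+ atRow1End _ (choose (range1 m) k))
        (cong (sumBy atRow1End (choose (range1 m) k) +_) (sumBy-+ (countMaxAtRow2End (suc n0) m) atRow3 (choose (range1 m) k))) ⟩
      sumBy atRow1End (choose (range1 m) k) + (sumBy (countMaxAtRow2End (suc n0) m) (choose (range1 m) k)
          + sumBy atRow3 (choose (range1 m) k))
    ≡⟨ cong₂ _+_ (sumBy-maxInRow1 n0 m k h) (cong₂ _+_ (sumBy-maxInRow2 (suc n0) m k) (sumBy-maxInRow3 (suc n0) m k)) ⟩
      dropRow1 n0 m k + (dropRow2 (suc n0) m k + dropRow3 (suc n0) m k) ∎
    where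
    open ≡-Reasoning
    atRow1End = λ S → countMaxAt (suc n0) m S ((1 , suc n0) , shapeB3 n0 m S)
    atRow3 = λ S → sumBy (λ sr → countB3 (suc n0) m (proj₂ sr)) (picks S)

  Bℕ : ℕ → ℕ → ℕ → ℕ
  Bℕ k i j = if k ≤ᵇ j then bnmk (i + j) j k else 0

  Fℕ : ℕ → ℕ → ℕ → ℕ
  Fℕ zero zero zero = 1
  Fℕ zero zero (suc j) = 0
  Fℕ zero (suc i) j = 0
  Fℕ (suc k) i j = if suc k ≤ᵇ j then (j ∸ k) * bnmk (i + j) j k else 0

  -- [x^a t^j] of x B_k and of (t/x) B_k.
  xBℕ : ℕ → ℕ → ℕ → ℕ
  xBℕ k zero j = 0
  xBℕ k (suc a) j = Bℕ k a j

  tOverXBℕ : ℕ → ℕ → ℕ → ℕ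
  tOverXBℕ k a zero = 0
  tOverXBℕ k a (suc j) = Bℕ k (suc a) j

  bnmk-empty : (n m k : ℕ) → m < k → bnmk n m k ≡ 0
  bnmk-empty n m k lt rewrite choose-empty (range1 m) k (subst (_< k) (sym (length-applyUpTo suc m)) lt) = refl

  bnmk-guard : (k N j' : ℕ) → k ≤ suc j' → bnmk N j' k ≡ (if k ≤ᵇ j' then bnmk N j' k else 0)
  bnmk-guard k N j' h with ≤-<-connex k j'
  ... | inj₁ le rewrite ≤ᵇ-true le = refl
  ... | inj₂ gt rewrite ≤ᵇ-false gt = bnmk-empty N j' k gt

  dropRow3≡Fℕ : (k a j : ℕ) → k ≤ j → (k ≡ 0 → a + j ≢ 0) → dropRow3 (a + j) j k ≡ Fℕ k a j
  dropRow3≡Fℕ zero zero zero h nz = ⊥-elim (nz refl refl)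
  dropRow3≡Fℕ zero zero (suc j) h nz = refl
  dropRow3≡Fℕ zero (suc a) j h nz = refl
  dropRow3≡Fℕ (suc k) a j h nz rewrite ≤ᵇ-true h = refl

  Bℕ-recurrence-≤ : (k a j : ℕ) → k ≤ j → Bℕ k a j ≡ xBℕ k a j + (tOverXBℕ k a j + Fℕ k a j)
  Bℕ-recurrence-≤ zero zero zero h = refl
  Bℕ-recurrence-≤ k zero (suc j') h rewrite ≤ᵇ-true h = trans (bnmk-recurrence j' (suc j') k ≤-refl)
    (cong₂ _+_ (cong (λ b → if b then bnmk j' (suc j') k else 0) (≤ᵇ-false {suc j'} {j'} ≤-refl))
      (cong₂ _+_ (bnmk-guard k (suc j') j' h) (dropRow3≡Fℕ k zero (suc j') h (λ _ ()))))
  Bℕ-recurrence-≤ k (suc a') j h rewrite ≤ᵇ-true h = trans (bnmk-recurrence (a' + j) j k (m≤n⇒m≤1+n (m≤n+m j a')))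
    (cong₂ _+_ (cong (λ b → if b then bnmk (a' + j) j k else 0) (≤ᵇ-true (m≤n+m j a')))
      (cong₂ _+_ (dropRow2-shift j h) (dropRow3≡Fℕ k (suc a') j h (λ _ ()))))
    where
    dropRow2-shift : ∀ j → k ≤ j → dropRow2 (suc (a' + j)) j k ≡ tOverXBℕ k (suc a') j
    dropRow2-shift zero h = refl
    dropRow2-shift (suc j') h = trans (cong (λ z → bnmk (suc z) j' k) (+-suc a' j')) (bnmk-guard k (suc (suc a' + j')) j' h)

  Bℕ-recurrence-> : (k a j : ℕ) → j < k → Bℕ k a j ≡ xBℕ k a j + (tOverXBℕ k a j + Fℕ k a j)
  Bℕ-recurrence-> (suc k) a j lt rewrite ≤ᵇ-false lt = sym (cong₂ _+_ (xBℕ-vanish a) (cong₂ _+_ (tOverXBℕ-vanish j lt) refl))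
    where
    xBℕ-vanish : ∀ a → xBℕ (suc k) a j ≡ 0
    xBℕ-vanish zero = refl
    xBℕ-vanish (suc a) rewrite ≤ᵇ-false lt = refl
    tOverXBℕ-vanish : ∀ j → j < suc k → tOverXBℕ (suc k) a j ≡ 0
    tOverXBℕ-vanish zero _ = refl
    tOverXBℕ-vanish (suc j') lt' rewrite ≤ᵇ-false {suc k} {j'} (<-trans (n<1+n j') lt') = refl

  Bℕ-recurrence : (k a j : ℕ) → Bℕ k a j ≡ xBℕ k a j + (tOverXBℕ k a j + Fℕ k a j)
  Bℕ-recurrence k a j with ≤-<-connex k j
  ... | inj₁ le = Bℕ-recurrence-≤ k a j le
  ... | inj₂ gt = Bℕ-recurrence-> k a j gt

  -- Rotating b_{n,k} fillings into b_{n,n,k} fillings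

  insertions-map : (f : A → A′) (x : A) (p : List A) → insertions (f x) (map f p) ≡ map (map f) (insertions x p)
  insertions-map f x [] = refl
  insertions-map f x (y ∷ p) = cong ((f x ∷ f y ∷ map f p) ∷_)
      (trans (cong (map (f y ∷_)) (insertions-map f x p))
      (trans (sym (map-∘ (insertions x p))) (map-∘ (insertions x p))))

  sumBy-permutations-map : (F : List A′ → ℕ) (f : A → A′) (xs : List A) → sumBy F (permutations (map f xs))
      ≡ sumBy (F ∘ map f) (permutations xs)
  sumBy-permutations-map F f [] = refl
  sumBy-permutations-map F f (x ∷ xs) = begin
      sumBy F (concatMap (insertions (f x)) (permutations (map f xs)))
    ≡⟨ sumBy-concatMap F (insertions (f x)) (permutations (map f xs)) ⟩
      sumBy (λ p → sumBy F (insertions (f x) p)) (permutations (map f xs))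
    ≡⟨ sumBy-permutations-map (λ p → sumBy F (insertions (f x) p)) f xs ⟩
      sumBy (λ p → sumBy F (insertions (f x) (map f p))) (permutations xs)
    ≡⟨ sumBy-cong (permutations xs) (λ p → trans (cong (sumBy F) (insertions-map f x p))
        (sumBy-map F (map f) (insertions x p))) ⟩
      sumBy (λ p → sumBy (F ∘ map f) (insertions x p)) (permutations xs)
    ≡⟨ sym (sumBy-concatMap (F ∘ map f) (insertions x) (permutations xs)) ⟩
      sumBy (F ∘ map f) (concatMap (insertions x) (permutations xs)) ∎
    where open ≡-Reasoning

  memCell : Cell → List Cell → Bool
  memCell y [] = false
  memCell y (t ∷ σ) = sameCell t y ∨ memCell y σ

  insertions-memCell : (x : Cell) (p : List Cell) → All (λ τ → ∀ y → memCell y τ ≡ memCell y (x ∷ p)) (insertions x p)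
  insertions-memCell x [] = (λ y → refl) ∷ []
  insertions-memCell x (z ∷ p) = (λ y → refl) ∷ map⁺
      (All.map (λ {τ} h y → trans (cong (sameCell z y ∨_) (h y))
      (∨-left-comm (sameCell z y) (sameCell x y) (memCell y p))) (insertions-memCell x p))

  permutations-memCell : (xs : List Cell) → All (λ σ → ∀ y → memCell y σ ≡ memCell y xs) (permutations xs)
  permutations-memCell [] = (λ y → refl) ∷ []
  permutations-memCell (x ∷ xs) = concat⁺
      (map⁺ (All.map (λ {p} h → All.map (λ {τ} h' y → trans (h' y) (cong (sameCell x y ∨_) (h y)))
      (insertions-memCell x p)) (permutations-memCell xs)))

  insertions-distinct : (x : Cell) (p : List Cell) → Fresh x p → Distinct p → All Distinct (insertions x p)
  insertions-distinct x [] ni d = ([] , tt) ∷ []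
  insertions-distinct x (z ∷ p) (e ∷ ni) (nz , d) = (e ∷ ni , nz , d) ∷ map⁺ (All.zipWith (λ (h , dτ) → proj₁ h , dτ)
    (All-insertions (λ y → sameCell z y ≡ false) x p (trans (sameCell-sym z x) e) nz , insertions-distinct x p ni d))

  permutations-distinct : (xs : List Cell) → Distinct xs → All Distinct (permutations xs)
  permutations-distinct [] d = tt ∷ []
  permutations-distinct (x ∷ xs) (nx , d) = concat⁺
      (map⁺ (All.zipWith (λ (h , dσ) → insertions-distinct x _ (proj₁ h) dσ)
    (All-permutations (λ y → sameCell x y ≡ false) xs nx , permutations-distinct xs d)))

  range1-cons : ∀ n → range1 (suc n) ≡ 1 ∷ map suc (range1 n)
  range1-cons n = cong (1 ∷_) (sym (map-applyUpTo suc suc n))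

  val-zip-map-suc : (σ : List Cell) (R : List ℕ) → length σ ≡ length R → ∀ y → val (zip σ (map suc R)) y
      ≡ (if memCell y σ then suc (val (zip σ R) y) else 0)
  val-zip-map-suc [] [] e y = refl
  val-zip-map-suc (t ∷ σ) (r ∷ R) e y with sameCell t y
  ... | true = refl
  ... | false = val-zip-map-suc σ R (suc-injective e) y

  val-zip-∷ʳ : (τ : List Cell) (R : List ℕ) (c : Cell) (v : ℕ) → length τ ≡ length R → ∀ y →
    val (zip τ R ∷ʳ (c , v)) y ≡ (if memCell y τ then val (zip τ R) y else (if sameCell c y then v else 0))
  val-zip-∷ʳ [] [] c v e y = refl
  val-zip-∷ʳ (t ∷ τ) (r ∷ R) c v e y with sameCell t y
  ... | true = refl
  ... | false = val-zip-∷ʳ τ R c v (suc-injective e) y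

  memCell-∷ʳ : (y a : Cell) (xs : List Cell) → memCell y (xs ∷ʳ a) ≡ (memCell y xs ∨ sameCell a y)
  memCell-∷ʳ y a [] = ∨-comm (sameCell a y) false
  memCell-∷ʳ y a (x ∷ xs) rewrite memCell-∷ʳ y a xs = sym (∨-assoc (sameCell x y) (memCell y xs) (sameCell a y))

  memCell-reverse : (y : Cell) (xs : List Cell) → memCell y (reverse xs) ≡ memCell y xs
  memCell-reverse y [] = refl
  memCell-reverse y (x ∷ xs) rewrite unfold-reverse x xs | memCell-∷ʳ y x
      (reverse xs) | memCell-reverse y xs = ∨-comm (memCell y xs) (sameCell x y)

  Fresh⇒memCell-false : (s : Cell) (σ : List Cell) → Fresh s σ → memCell s σ ≡ false
  Fresh⇒memCell-false s [] [] = refl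
  Fresh⇒memCell-false s (t ∷ σ) (e ∷ ni) rewrite sameCell-sym t s | e = Fresh⇒memCell-false s σ ni

  val-zip-reverse : (σ : List Cell) → Distinct σ → ∀ y → val (zip (reverse σ) (range1 (length σ))) y
      ≡ (if memCell y σ then suc (length σ) ∸ val (zip σ (range1 (length σ))) y else 0)
  val-zip-reverse [] d y = refl
  val-zip-reverse (s ∷ σ) (ns , d) y = begin
      val (zip (reverse (s ∷ σ)) (range1 (suc n))) y
    ≡⟨ cong₂ (λ a b → val (zip a b) y) (unfold-reverse s σ) (range1-suc n) ⟩
      val (zip (reverse σ ∷ʳ s) (range1 n ∷ʳ suc n)) y
    ≡⟨ cong (λ z → val z y) (zip-∷ʳ (reverse σ) (range1 n) s (suc n)
        (trans (length-reverse σ) (sym (length-applyUpTo suc n)))) ⟩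
      val (zip (reverse σ) (range1 n) ∷ʳ (s , suc n)) y
    ≡⟨ val-zip-∷ʳ (reverse σ) (range1 n) s (suc n) (trans (length-reverse σ) (sym (length-applyUpTo suc n))) y ⟩
      (if memCell y (reverse σ) then val (zip (reverse σ) (range1 n)) y else (if sameCell s y then suc n else 0))
    ≡⟨ cong₂ (λ b z → if b then z else (if sameCell s y then suc n else 0)) (memCell-reverse y σ)
        (val-zip-reverse σ d y) ⟩
      (if memCell y σ then (if memCell y σ then suc n ∸ val (zip σ (range1 n)) y else 0) else
          (if sameCell s y then suc n else 0))
    ≡⟨ cases ⟩
      (if sameCell s y ∨ memCell y σ then suc (suc n) ∸
          (if sameCell s y then 1 else (if memCell y σ then suc (val (zip σ (range1 n)) y) else 0)) else 0)
    ≡⟨ cong (λ z → if sameCell s y ∨ memCell y σ then suc (suc n) ∸ (if sameCell s y then 1 else z) else 0)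
        (sym (val-zip-map-suc σ (range1 n) (sym (length-applyUpTo suc n)) y)) ⟩
      (if sameCell s y ∨ memCell y σ then suc (suc n) ∸ val (zip (s ∷ σ) (1 ∷ map suc (range1 n))) y else 0)
    ≡⟨ cong (λ z → if sameCell s y ∨ memCell y σ then suc (suc n) ∸ val (zip (s ∷ σ) z) y else 0)
        (sym (range1-cons n)) ⟩
      (if memCell y (s ∷ σ) then suc (length (s ∷ σ)) ∸ val (zip (s ∷ σ) (range1 (length (s ∷ σ)))) y else 0) ∎
    where
    open ≡-Reasoning
    n = length σ
    cases : (if memCell y σ then (if memCell y σ then suc n ∸ val (zip σ (range1 n)) y else 0) else
        (if sameCell s y then suc n else 0))
          ≡ (if sameCell s y ∨ memCell y σ then suc (suc n) ∸
              (if sameCell s y then 1 else (if memCell y σ then suc (val (zip σ (range1 n)) y) else 0)) else 0)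
    cases with sameCell s y in e1 | memCell y σ in e2
    ... | true | true = ⊥-elim (false≢true (trans (sym (Fresh⇒memCell-false s σ ns))
        (subst (λ z → memCell z σ ≡ true) (sym (sameCell⇒≡ s y e1)) e2)))
    ... | true | false = refl
    ... | false | true = refl
    ... | false | false = refl

  rotate : ℕ → Cell → Cell
  rotate m (r , j) = (4 ∸ r , suc m ∸ j)

  InBox : ℕ → Cell → Set
  InBox m (r , j) = (1 ≤ r × r ≤ 3) × (1 ≤ j × j ≤ m)

  ≡ᵇ-iff : ∀ a b c d → (a ≡ b → c ≡ d) → (c ≡ d → a ≡ b) → (a ≡ᵇ b) ≡ (c ≡ᵇ d)
  ≡ᵇ-iff a b c d f g with a ≡ᵇ b in e1 | c ≡ᵇ d in e2
  ... | true | true = refl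
  ... | false | false = refl
  ... | true | false = ⊥-elim (false≢true (trans (sym e2) (subst (λ z → (c ≡ᵇ z) ≡ true) (f (≡ᵇ-true a b e1)) (≡ᵇ-refl c))))
  ... | false | true = ⊥-elim (false≢true (trans (sym e1) (subst (λ z → (a ≡ᵇ z) ≡ true) (g (≡ᵇ-true c d e2)) (≡ᵇ-refl a))))

  sameCell-rotate : (m : ℕ) (a b : Cell) → InBox m a → InBox m b → sameCell (rotate m a) (rotate m b) ≡ sameCell a b
  sameCell-rotate m (r , j) (r' , j') ((_ , r≤) , (_ , j≤)) ((_ , r'≤) , (_ , j'≤)) =
    cong₂ _∧_ (≡ᵇ-iff (4 ∸ r) (4 ∸ r') r r' (∸-cancelˡ-≡ (m≤n⇒m≤1+n r≤) (m≤n⇒m≤1+n r'≤)) (cong (4 ∸_)))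
              (≡ᵇ-iff (suc m ∸ j) (suc m ∸ j') j j' (∸-cancelˡ-≡ (m≤n⇒m≤1+n j≤) (m≤n⇒m≤1+n j'≤)) (cong (suc m ∸_)))

  rotate-involutive : (m : ℕ) (y : Cell) → InBox m y → rotate m (rotate m y) ≡ y
  rotate-involutive m (r , j) ((_ , r≤) , (_ , j≤)) = cong₂ _,_ (m∸[m∸n]≡n (m≤n⇒m≤1+n r≤)) (m∸[m∸n]≡n (m≤n⇒m≤1+n j≤))

  rotate-InBox : (m : ℕ) (y : Cell) → InBox m y → InBox m (rotate m y)
  rotate-InBox m (suc r0 , suc j0) ((1≤r , r≤3) , (1≤j , j≤m)) = (m<n⇒0<n∸m r≤3 , m∸n≤m 3 r0) ,
      (m<n⇒0<n∸m j≤m , m∸n≤m m j0)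

  val-rotate : (m : ℕ) (τ : List Cell) (R : List ℕ) (x : Cell) → All (InBox m) τ → InBox m x
      → val (zip (map (rotate m) τ) R) (rotate m x) ≡ val (zip τ R) x
  val-rotate m [] R x a bx = refl
  val-rotate m (t ∷ τ) [] x a bx = refl
  val-rotate m (t ∷ τ) (r ∷ R) x (bt ∷ a) bx rewrite sameCell-rotate m t x bt bx with sameCell t x
  ... | true = refl
  ... | false = val-rotate m τ R x a bx

  ∸-<ᵇ-flip : ∀ N a b → a ≤ suc N → b ≤ suc N → ((suc N ∸ a) <ᵇ (suc N ∸ b)) ≡ (b <ᵇ a)
  ∸-<ᵇ-flip N a b ha hb with <-≤-connex b a
  ... | inj₁ lt = trans (<ᵇ-true (∸-monoʳ-< lt ha)) (sym (<ᵇ-true lt))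
  ... | inj₂ ge = trans (<ᵇ-false (∸-monoʳ-≤ (suc N) ge)) (sym (<ᵇ-false ge))

  memCell-++ : (y : Cell) (xs ys : List Cell) → memCell y (xs ++ ys) ≡ (memCell y xs ∨ memCell y ys)
  memCell-++ y [] ys = refl
  memCell-++ y (x ∷ xs) ys rewrite memCell-++ y xs ys = sym (∨-assoc (sameCell x y) (memCell y xs) (memCell y ys))

  memCell-row : (r m i : ℕ) → 1 ≤ i → i ≤ m → memCell (r , i) (map (r ,_) (range1 m)) ≡ true
  memCell-row r zero (suc i) a ()
  memCell-row r (suc m) i a b = trans (cong (λ z → memCell (r , i) (map (r ,_) z)) (range1-suc m))
    (trans (cong (memCell (r , i)) (map-++ (r ,_) (range1 m) (suc m ∷ [])))
    (trans (memCell-∷ʳ (r , i) (r , suc m) (map (r ,_) (range1 m))) (cases (m≤n⇒m<n∨m≡n b))))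
    where
    cases : (i < suc m) ⊎ (i ≡ suc m) → (memCell (r , i) (map (r ,_) (range1 m)) ∨ sameCell (r , suc m) (r , i)) ≡ true
    cases (inj₁ (s≤s lt)) rewrite memCell-row r m i a lt = refl
    cases (inj₂ refl) rewrite sameCell-refl (r , suc m) = ∨-comm _ true

  memCell-list : (r : ℕ) (S : List ℕ) → All (λ s → memCell (r , s) (map (r ,_) S) ≡ true) S
  memCell-list r [] = []
  memCell-list r (x ∷ S) = (trans (cong (_∨ memCell (r , x) (map (r ,_) S))
      (sameCell-refl (r , x))) refl) ∷ All.map
      (λ {s} e → trans (cong (sameCell (r , x) (r , s) ∨_) e) (∨-comm _ true)) (memCell-list r S)

  allB-map : (p : A′ → Bool) (f : A → A′) (xs : List A) → allB p (map f xs) ≡ allB (p ∘ f) xs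
  allB-map p f [] = refl
  allB-map p f (x ∷ xs) = cong (p (f x) ∧_) (allB-map p f xs)

  allB-reverse : (p : A → Bool) (xs : List A) → allB p (reverse xs) ≡ allB p xs
  allB-reverse p [] = refl
  allB-reverse p (x ∷ xs) rewrite unfold-reverse x xs | allB-∷ʳ p (reverse xs) x | allB-reverse p xs = ∧-comm
      (allB p xs) (p x)

  reverse-∷ʳ : (xs : List A) (y : A) → reverse (xs ∷ʳ y) ≡ y ∷ reverse xs
  reverse-∷ʳ xs y = reverse-++ xs (y ∷ [])

  map-∸-range1 : ∀ L → map (suc L ∸_) (range1 L) ≡ reverse (range1 L)
  map-∸-range1 zero = refl
  map-∸-range1 (suc L) = begin
      map (suc (suc L) ∸_) (range1 (suc L))
    ≡⟨ cong (map (suc (suc L) ∸_)) (range1-cons L) ⟩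
      suc L ∷ map (suc (suc L) ∸_) (map suc (range1 L))
    ≡⟨ cong (suc L ∷_) (trans (sym (map-∘ (range1 L))) (map-∸-range1 L)) ⟩
      suc L ∷ reverse (range1 L)
    ≡⟨ sym (reverse-∷ʳ (range1 L) (suc L)) ⟩
      reverse (range1 L ∷ʳ suc L)
    ≡⟨ cong reverse (sym (range1-suc L)) ⟩
      reverse (range1 (suc L)) ∎
    where open ≡-Reasoning

  allB-range1-reflect : (p : ℕ → Bool) (L : ℕ) → allB (λ j → p (suc L ∸ j)) (range1 L) ≡ allB p (range1 L)
  allB-range1-reflect p L = trans (sym (allB-map p (suc L ∸_) (range1 L)))
      (trans (cong (allB p) (map-∸-range1 L)) (allB-reverse p (range1 L)))

  All-reverse : {Q : A → Set} (xs : List A) → All Q xs → All Q (reverse xs)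
  All-reverse [] [] = []
  All-reverse (x ∷ xs) (q ∷ qs) rewrite unfold-reverse x xs = ++⁺ (All-reverse xs qs) (q ∷ [])

  valid₂ : ℕ → List ℕ → (Cell → ℕ) → Bool
  valid₂ m S g = rowIncreasing g 2 m ∧ rowIncreasing g 3 m ∧ columnIncreasing g 2 3 (range1 m)
      ∧ columnIncreasing g 1 2 S

  RespectsVal-valid₂ : (m : ℕ) (S : List ℕ) → RespectsVal (λ T → valid₂ m S (val T))
  RespectsVal-valid₂ m S T₁ T₂ e = cong₂ _∧_ (rowIncreasing-cong (val T₁) (val T₂) 2 m e)
      (cong₂ _∧_ (rowIncreasing-cong (val T₁) (val T₂) 3 m e)
      (cong₂ _∧_ (columnIncreasing-cong (val T₁) (val T₂) 2 3 (range1 m) e)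
      (columnIncreasing-cong (val T₁) (val T₂) 1 2 S e)))

  mirror : ℕ → List ℕ → List ℕ
  mirror m S = reverse (map (suc m ∸_) S)

  suc[m∸1]≡m : ∀ m → 1 ≤ m ∸ 1 → suc (m ∸ 1) ≡ m
  suc[m∸1]≡m (suc m) _ = refl

  -- Listing the rotated cells in reverse order gives each of them the complementary entry N + 1 - v.
  module Rotation (m : ℕ) (S : List ℕ) (bS : All (λ s → 1 ≤ s × s ≤ m) S) (σ : List Cell) (dσ : Distinct σ)
              (memσ : ∀ y → memCell y σ ≡ memCell y (shapeB2 m S)) (boxσ : All (InBox m) σ) where

    N : ℕ
    N = length σ
    T₂ : Cell → ℕ
    T₂ = val (zip σ (range1 N))
    T₃ : Cell → ℕ
    T₃ = val (zip (map (rotate m) (reverse σ)) (range1 N))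

    shape₂ = shapeB2 m S

    T₃≡complement : (y : Cell) → InBox m y → memCell (rotate m y) shape₂ ≡ true → T₃ y ≡ suc N ∸ T₂ (rotate m y)
    T₃≡complement y by my = begin
        T₃ y
      ≡⟨ cong T₃ (sym (rotate-involutive m y by)) ⟩
        T₃ (rotate m (rotate m y))
      ≡⟨ val-rotate m (reverse σ) (range1 N) (rotate m y) (All-reverse σ boxσ) (rotate-InBox m y by) ⟩
        val (zip (reverse σ) (range1 N)) (rotate m y)
      ≡⟨ val-zip-reverse σ dσ (rotate m y) ⟩
        (if memCell (rotate m y) σ then suc N ∸ T₂ (rotate m y) else 0)
      ≡⟨ cong (λ b → if b then suc N ∸ T₂ (rotate m y) else 0) (trans (memσ (rotate m y)) my) ⟩
        suc N ∸ T₂ (rotate m y) ∎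
      where open ≡-Reasoning

    T₂-≤ : ∀ x → T₂ x ≤ suc N
    T₂-≤ x = m≤n⇒m≤1+n (val-range1-≤ σ N x)

    T₃-<ᵇ : (y1 y2 : Cell) → InBox m y1 → InBox m y2 → memCell (rotate m y1) shape₂ ≡ true
        → memCell (rotate m y2) shape₂ ≡ true →
      (T₃ y1 <ᵇ T₃ y2) ≡ (T₂ (rotate m y2) <ᵇ T₂ (rotate m y1))
    T₃-<ᵇ y1 y2 b1 b2 m1 m2 = trans (cong₂ _<ᵇ_ (T₃≡complement y1 b1 m1) (T₃≡complement y2 b2 m2))
        (∸-<ᵇ-flip N (T₂ (rotate m y1)) (T₂ (rotate m y2)) (T₂-≤ _) (T₂-≤ _))

    row3∈shape₂ : ∀ i → 1 ≤ i → i ≤ m → memCell (3 , i) shape₂ ≡ true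
    row3∈shape₂ i a b rewrite memCell-++ (3 , i) (map (3 ,_) (range1 m))
        (map (2 ,_) (range1 m) ++ map (1 ,_) S) | memCell-row 3 m i a b = refl

    row2∈shape₂ : ∀ i → 1 ≤ i → i ≤ m → memCell (2 , i) shape₂ ≡ true
    row2∈shape₂ i a b rewrite memCell-++ (2 , i) (map (3 ,_) (range1 m)) (map (2 ,_) (range1 m) ++ map (1 ,_) S)
      | memCell-++ (2 , i) (map (2 ,_) (range1 m)) (map (1 ,_) S) | memCell-row 2 m i a b = ∨-comm _ true

    row1∈shape₂ : All (λ s → memCell (1 , s) shape₂ ≡ true) S
    row1∈shape₂ = All.map (λ {s} e → trans (memCell-++ (1 , s) (map (3 ,_) (range1 m)) (map (2 ,_) (range1 m) ++ map (1 ,_) S))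
       (trans (cong (memCell (1 , s) (map (3 ,_) (range1 m)) ∨_)
           (trans (memCell-++ (1 , s) (map (2 ,_) (range1 m)) (map (1 ,_) S))
           (trans (cong (memCell (1 , s) (map (2 ,_) (range1 m)) ∨_) e) (∨-comm _ true)))) (∨-comm _ true)))
           (memCell-list 1 S)

    reflect-≥1 : ∀ j → 1 ≤ j → j ≤ m → 1 ≤ suc m ∸ j
    reflect-≥1 j a b = m<n⇒0<n∸m (s≤s b)
    reflect-≤m : ∀ j → 1 ≤ j → suc m ∸ j ≤ m
    reflect-≤m (suc j) a = m∸n≤m m j

    row-rotate : (r : ℕ) → 1 ≤ r → r ≤ 3 → (∀ i → 1 ≤ i → i ≤ m → memCell (4 ∸ r , i) shape₂ ≡ true) →
      allB (λ j → T₃ (r , j) <ᵇ T₃ (r , suc j)) (range1 (m ∸ 1))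
          ≡ allB (λ i → T₂ (4 ∸ r , i) <ᵇ T₂ (4 ∸ r , suc i)) (range1 (m ∸ 1))
    row-rotate r r1 r3 memr = trans (allB-congAll _ _ (range1 (m ∸ 1)) (All-range1 (m ∸ 1)) pointwise)
        (allB-range1-reflect q (m ∸ 1))
      where
      q = λ i → T₂ (4 ∸ r , i) <ᵇ T₂ (4 ∸ r , suc i)
      pointwise : ∀ j → 1 ≤ j × j ≤ m ∸ 1 → (T₃ (r , j) <ᵇ T₃ (r , suc j)) ≡ q (suc (m ∸ 1) ∸ j)
      pointwise j (a , b) = trans (T₃-<ᵇ (r , j) (r , suc j) ((r1 , r3) , (a , jm)) ((r1 , r3) , (s≤s z≤n , sjm))
                             (memr (suc m ∸ j) (reflect-≥1 j a jm) (reflect-≤m j a))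
                                 (memr (suc m ∸ suc j) (reflect-≥1 (suc j) (s≤s z≤n) sjm) (reflect-≤m (suc j) (s≤s z≤n))))
                      (cong₂ (λ u v → T₂ (4 ∸ r , u) <ᵇ T₂ (4 ∸ r , v)) e1 e2)
        where
        em : suc (m ∸ 1) ≡ m
        em = suc[m∸1]≡m m (≤-trans a b)
        jm : j ≤ m
        jm = ≤-trans b (m∸n≤m m 1)
        sjm : suc j ≤ m
        sjm = subst (suc j ≤_) em (s≤s b)
        e1 : suc m ∸ suc j ≡ suc (m ∸ 1) ∸ j
        e1 = cong (_∸ j) (sym em)
        e2 : suc m ∸ j ≡ suc (suc (m ∸ 1) ∸ j)
        e2 = trans (+-∸-assoc 1 jm) (cong (λ z → suc (z ∸ j)) (sym em))

    columns12-rotate : allB (λ j → T₃ (1 , j) <ᵇ T₃ (2 , j)) (range1 m) ≡ allB (λ i → T₂ (2 , i) <ᵇ T₂ (3 , i)) (range1 m)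
    columns12-rotate = trans (allB-congAll _ _ (range1 m) (All-range1 m) pointwise)
        (allB-range1-reflect (λ i → T₂ (2 , i) <ᵇ T₂ (3 , i)) m)
      where
      pointwise : ∀ j → 1 ≤ j × j ≤ m → (T₃ (1 , j) <ᵇ T₃ (2 , j)) ≡ (T₂ (2 , suc m ∸ j) <ᵇ T₂ (3 , suc m ∸ j))
      pointwise j (a , b) = T₃-<ᵇ (1 , j) (2 , j) ((s≤s z≤n , s≤s z≤n) , (a , b)) ((s≤s z≤n , s≤s (s≤s z≤n)) , (a , b))
        (row3∈shape₂ (suc m ∸ j) (reflect-≥1 j a b) (reflect-≤m j a)) (row2∈shape₂ (suc m ∸ j) (reflect-≥1 j a b) (reflect-≤m j a))

    columns23-rotate : allB (λ s → T₃ (2 , s) <ᵇ T₃ (3 , s)) (mirror m S) ≡ allB (λ s → T₂ (1 , s) <ᵇ T₂ (2 , s)) S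
    columns23-rotate = trans (allB-reverse _ (map (suc m ∸_) S))
        (trans (allB-map _ (suc m ∸_) S) (allB-congAll _ _ S (All.zip (bS , row1∈shape₂)) pointwise))
      where
      pointwise : ∀ s → (1 ≤ s × s ≤ m) × memCell (1 , s) shape₂ ≡ true → (T₃ (2 , suc m ∸ s) <ᵇ T₃ (3 , suc m ∸ s))
          ≡ (T₂ (1 , s) <ᵇ T₂ (2 , s))
      pointwise s ((a , b) , ms) = trans (T₃-<ᵇ (2 , suc m ∸ s) (3 , suc m ∸ s)
          ((s≤s z≤n , s≤s (s≤s z≤n)) , (reflect-≥1 s a b , reflect-≤m s a)) ((s≤s z≤n , ≤-refl) , (reflect-≥1 s a b , reflect-≤m s a))
          (subst (λ z → memCell (2 , z) shape₂ ≡ true) (sym ee) (row2∈shape₂ s a b))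
              (subst (λ z → memCell (1 , z) shape₂ ≡ true) (sym ee) ms))
        (cong (λ z → T₂ (1 , z) <ᵇ T₂ (2 , z)) ee)
        where
        ee : suc m ∸ (suc m ∸ s) ≡ s
        ee = m∸[m∸n]≡n (m≤n⇒m≤1+n b)

    valid₃-rotate : valid₃ m m (mirror m S) T₃ ≡ valid₂ m S T₂
    valid₃-rotate = trans (cong₂ _∧_ (row-rotate 1 (s≤s z≤n) (s≤s z≤n) row3∈shape₂)
        (cong₂ _∧_ (row-rotate 2 (s≤s z≤n) (s≤s (s≤s z≤n)) row2∈shape₂) (cong₂ _∧_ columns12-rotate columns23-rotate)))
      (∧-left-comm (rowIncreasing T₂ 3 m) (rowIncreasing T₂ 2 m) _)

  choose-map : (f : ℕ → ℕ) (xs : List ℕ) (k : ℕ) → choose (map f xs) k ≡ map (map f) (choose xs k)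
  choose-map f xs zero = refl
  choose-map f [] (suc k) = refl
  choose-map f (x ∷ xs) (suc k) rewrite choose-map f xs k | choose-map f xs (suc k)
    | map-++ (map f) (map (x ∷_) (choose xs k)) (choose xs (suc k)) = cong
        (_++ map (map f) (choose xs (suc k))) (trans (sym (map-∘ (choose xs k))) (map-∘ (choose xs k)))

  sumBy-choose-reverse : (G : List ℕ → ℕ) (L : List ℕ) (k : ℕ) → sumBy (G ∘ reverse) (choose (reverse L) k)
      ≡ sumBy G (choose L k)
  sumBy-choose-reverse G L zero = refl
  sumBy-choose-reverse G [] (suc k) = refl
  sumBy-choose-reverse G (x ∷ L) (suc k) = begin
      sumBy (G ∘ reverse) (choose (reverse (x ∷ L)) (suc k))
    ≡⟨ cong (λ z → sumBy (G ∘ reverse) (choose z (suc k))) (unfold-reverse x L) ⟩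
      sumBy (G ∘ reverse) (choose (reverse L ∷ʳ x) (suc k))
    ≡⟨ sumBy-choose-∷ʳ (G ∘ reverse) (reverse L) x k ⟩
      sumBy (G ∘ reverse) (choose (reverse L) (suc k)) + sumBy (λ S → G (reverse (S ∷ʳ x))) (choose (reverse L) k)
    ≡⟨ cong₂ _+_ (sumBy-choose-reverse G L (suc k))
        (trans (sumBy-cong (choose (reverse L) k) (λ S → cong G (reverse-∷ʳ S x)))
        (sumBy-choose-reverse (G ∘ (x ∷_)) L k)) ⟩
      sumBy G (choose L (suc k)) + sumBy (G ∘ (x ∷_)) (choose L k)
    ≡⟨ +-comm (sumBy G (choose L (suc k))) (sumBy (G ∘ (x ∷_)) (choose L k)) ⟩
      sumBy (G ∘ (x ∷_)) (choose L k) + sumBy G (choose L (suc k))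
    ≡⟨ cong (_+ sumBy G (choose L (suc k))) (sym (sumBy-map G (x ∷_) (choose L k))) ⟩
      sumBy G (map (x ∷_) (choose L k)) + sumBy G (choose L (suc k))
    ≡⟨ sym (sumBy-++ G (map (x ∷_) (choose L k)) (choose L (suc k))) ⟩
      sumBy G (choose (x ∷ L) (suc k)) ∎
    where open ≡-Reasoning

  sumBy-choose-mirror : (G : List ℕ → ℕ) (m k : ℕ) → sumBy (G ∘ mirror m) (choose (range1 m) k)
      ≡ sumBy G (choose (range1 m) k)
  sumBy-choose-mirror G m k = begin
      sumBy (λ S → G (reverse (map (suc m ∸_) S))) (choose (range1 m) k)
    ≡⟨ sym (sumBy-map (G ∘ reverse) (map (suc m ∸_)) (choose (range1 m) k)) ⟩
      sumBy (G ∘ reverse) (map (map (suc m ∸_)) (choose (range1 m) k))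
    ≡⟨ cong (sumBy (G ∘ reverse)) (sym (choose-map (suc m ∸_) (range1 m) k)) ⟩
      sumBy (G ∘ reverse) (choose (map (suc m ∸_) (range1 m)) k)
    ≡⟨ cong (λ z → sumBy (G ∘ reverse) (choose z k)) (map-∸-range1 m) ⟩
      sumBy (G ∘ reverse) (choose (reverse (range1 m)) k)
    ≡⟨ sumBy-choose-reverse G (range1 m) k ⟩
      sumBy G (choose (range1 m) k) ∎
    where open ≡-Reasoning

  shapeB2-distinct : (m : ℕ) (S : List ℕ) → Increasing S → Distinct (shapeB2 m S)
  shapeB2-distinct m S iS = Distinct-++ (map (3 ,_) (range1 m)) _ (Distinct-row 3 (range1 m) (Increasing-range1 m))
    (Distinct-++ (map (2 ,_) (range1 m)) _ (Distinct-row 2 (range1 m) (Increasing-range1 m)) (Distinct-row 1 S iS)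
       (map⁺ (All.universal (λ j → Fresh-otherRow 2 1 (λ ()) j S) _)))
    (map⁺ (All.universal (λ j → ++⁺ (Fresh-otherRow 3 2 (λ ()) j (range1 m)) (Fresh-otherRow 3 1 (λ ()) j S)) _))

  shapeB2-InBox : (m : ℕ) (S : List ℕ) → All (λ s → 1 ≤ s × s ≤ m) S → All (InBox m) (shapeB2 m S)
  shapeB2-InBox m S bS = ++⁺ (map⁺ (All.map (λ {j} h → (s≤s z≤n , ≤-refl) , h) (All-range1 m))) 
    (++⁺ (map⁺ (All.map (λ {j} h → (s≤s z≤n , s≤s (s≤s z≤n)) , h) (All-range1 m))) 
      (map⁺ (All.map (λ {j} h → (s≤s z≤n , s≤s z≤n) , h) bS)))

  map-rotate-row : (m r : ℕ) (L : List ℕ) → map (rotate m) (map (r ,_) L) ≡ map (4 ∸ r ,_) (map (suc m ∸_) L)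
  map-rotate-row m r L = trans (sym (map-∘ L)) (map-∘ L)

  shapeB3-↭-rotate-shapeB2 : (m : ℕ) (S : List ℕ) → shapeB3 m m (mirror m S) ↭ map (rotate m) (shapeB2 m S)
  shapeB3-↭-rotate-shapeB2 m S = ↭.↭-trans (↭ₚ.++⁺ (↭ₚ.map⁺ (1 ,_) (↭.↭-sym (↭ₚ.↭-reverse (range1 m))))
                          (↭ₚ.++⁺ (↭ₚ.map⁺ (2 ,_) (↭.↭-sym (↭ₚ.↭-reverse (range1 m))))
                              (↭ₚ.map⁺ (3 ,_) (↭ₚ.↭-reverse (map (suc m ∸_) S)))))
    (↭.↭-reflexive (sym eq))
    where
    eq : map (rotate m) (shapeB2 m S) ≡ map (1 ,_) (reverse (range1 m)) ++ map (2 ,_)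
        (reverse (range1 m)) ++ map (3 ,_) (map (suc m ∸_) S)
    eq = begin
        map (rotate m) (map (3 ,_) (range1 m) ++ map (2 ,_) (range1 m) ++ map (1 ,_) S)
      ≡⟨ map-++ (rotate m) (map (3 ,_) (range1 m)) _ ⟩
        map (rotate m) (map (3 ,_) (range1 m)) ++ map (rotate m) (map (2 ,_) (range1 m) ++ map (1 ,_) S)
      ≡⟨ cong (map (rotate m) (map (3 ,_) (range1 m)) ++_) (map-++ (rotate m) (map (2 ,_) (range1 m)) _) ⟩
        map (rotate m) (map (3 ,_) (range1 m)) ++ map (rotate m) (map (2 ,_) (range1 m)) ++ map (rotate m)
            (map (1 ,_) S)
      ≡⟨ cong₂ (λ a b → a ++ b ++ map (rotate m) (map (1 ,_) S))
          (trans (map-rotate-row m 3 (range1 m)) (cong (map (1 ,_)) (map-∸-range1 m)))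
          (trans (map-rotate-row m 2 (range1 m)) (cong (map (2 ,_)) (map-∸-range1 m))) ⟩
        map (1 ,_) (reverse (range1 m)) ++ map (2 ,_) (reverse (range1 m)) ++ map (rotate m) (map (1 ,_) S)
      ≡⟨ cong (λ z → map (1 ,_) (reverse (range1 m)) ++ map (2 ,_) (reverse (range1 m)) ++ z) (map-rotate-row m 1 S) ⟩
        map (1 ,_) (reverse (range1 m)) ++ map (2 ,_) (reverse (range1 m)) ++ map (3 ,_) (map (suc m ∸_) S) ∎
      where open ≡-Reasoning

  countB3-mirror≡countB2 : (m : ℕ) (S : List ℕ) → Increasing S → All (λ s → 1 ≤ s × s ≤ m) S →
    countB3 m m (mirror m S) ≡ countByCells (shapeB2 m S) (λ T → valid₂ m S (val T))
  countB3-mirror≡countB2 m S iS bS = begin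
      sumBy indicator₃ (permutations shape₃)
    ≡⟨ sumBy-permutations-↭ (shapeB3-↭-rotate-shapeB2 m S) indicator₃ ⟩
      sumBy indicator₃ (permutations (map (rotate m) shape₂))
    ≡⟨ sumBy-permutations-map indicator₃ (rotate m) shape₂ ⟩
      sumBy (indicator₃ ∘ map (rotate m)) (permutations shape₂)
    ≡⟨ sym (sumBy-permutations-reverse shape₂ (indicator₃ ∘ map (rotate m))) ⟩
      sumBy (indicator₃ ∘ map (rotate m) ∘ reverse) (permutations shape₂)
    ≡⟨ sumBy-congAll (permutations shape₂)
        (All.zip (permutations-distinct shape₂ (shapeB2-distinct m S iS) , All.zip
        (permutations-memCell shape₂ , All-permutations (InBox m) shape₂ (shapeB2-InBox m S bS)))) pointwise ⟩
      sumBy (λ σ → indicator (λ T → valid₂ m S (val T)) (zip σ (range1 (length shape₂)))) (permutations shape₂) ∎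
    where
    open ≡-Reasoning
    shape₂ = shapeB2 m S
    shape₃ = shapeB3 m m (mirror m S)
    indicator₃ = λ σ → indicator (λ T → valid₃ m m (mirror m S) (val T)) (zip σ (range1 (length shape₃)))
    e : length shape₃ ≡ length shape₂
    e = trans (↭ₚ.↭-length (shapeB3-↭-rotate-shapeB2 m S)) (length-map (rotate m) shape₂)
    pointwise : ∀ σ → Distinct σ × (∀ y → memCell y σ ≡ memCell y shape₂) × (All (InBox m) σ × length σ ≡ length shape₂) →
       indicator₃ (map (rotate m) (reverse σ)) ≡ indicator (λ T → valid₂ m S (val T)) (zip σ (range1 (length shape₂)))
    pointwise σ (dσ , mσ , bσ , lσ) = cong (λ b → if b then 1 else 0)
      (subst (λ N → valid₃ m m (mirror m S) (val (zip (map (rotate m) (reverse σ)) (range1 N)))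
          ≡ valid₂ m S (val (zip σ (range1 (length shape₂)))))
        (sym e)
        (subst (λ N → valid₃ m m (mirror m S) (val (zip (map (rotate m) (reverse σ)) (range1 N)))
            ≡ valid₂ m S (val (zip σ (range1 N)))) lσ
          (Rotation.valid₃-rotate m S bS σ dσ mσ bσ)))

  bnk≡bnmk : (m k : ℕ) → bnk m k ≡ bnmk m m k
  bnk≡bnmk m k = begin
      bnk m k
    ≡⟨ sumℕ-map _ (choose (range1 m) k) ⟩
      sumBy (λ S → count (validB2 m S) (fillings (shapeB2 m S))) (choose (range1 m) k)
    ≡⟨ sumBy-congAll (choose (range1 m) k)
        (All.zip (choose-increasing (range1 m) k (Increasing-range1 m) , All-choose (range1 m) k (All-range1 m)))
        (λ S h → trans (count-fillings (shapeB2 m S) (shapeB2-distinct m S (proj₁ h)) (validB2 m S)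
            (RespectsVal-valid₂ m S)) (sym (countB3-mirror≡countB2 m S (proj₁ h) (proj₂ h)))) ⟩
      sumBy (λ S → countB3 m m (mirror m S)) (choose (range1 m) k)
    ≡⟨ sumBy-choose-mirror (countB3 m m) m k ⟩
      sumBy (countB3 m m) (choose (range1 m) k)
    ≡⟨ sym (bnmk≡sumBy-countB3 m m k) ⟩
      bnmk m m k ∎
    where open ≡-Reasoning

module Coefficients where

  open Tableaux

  open import Data.Bool using (Bool; true; false; if_then_else_)
  open import Data.Nat as ℕ using (ℕ; zero; suc; _∸_; _<_; _≤ᵇ_)
  import Data.Nat.Properties as NP
  open import Data.Integer using (ℤ; +_; _+_; _-_; _*_)
  import Data.Integer.Properties as ZP
  open ZP using (pos-+; pos-*)
  open import Data.Integer.Tactic.RingSolver using (solve-∀)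
  open import Data.List.Properties using (length-applyUpTo)
  open import Data.Sum using (inj₁; inj₂)
  open import Relation.Binary.PropositionalEquality

  B≡Bℕ : ∀ k i j → B k i j ≡ + Bℕ k i j
  B≡Bℕ k i j with k ≤ᵇ j
  ... | true = refl
  ... | false = refl

  F≡Fℕ : ∀ k i j → F k i j ≡ + Fℕ k i j
  F≡Fℕ zero zero zero = refl
  F≡Fℕ zero zero (suc j) = refl
  F≡Fℕ zero (suc i) j = refl
  F≡Fℕ (suc k) i j with suc k ≤ᵇ j
  ... | true = refl
  ... | false = refl

  bnk-empty : ∀ m k → m < k → bnk m k ≡ 0
  bnk-empty m k lt rewrite choose-empty (range1 m) k (subst (_< k) (sym (length-applyUpTo suc m)) lt) = refl

  Bℕ-column0 : ∀ k j → Bℕ k 0 j ≡ bnk j k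
  Bℕ-column0 k j with NP.≤-<-connex k j
  ... | inj₁ le rewrite ≤ᵇ-true le = sym (bnk≡bnmk j k)
  ... | inj₂ gt rewrite ≤ᵇ-false gt = sym (bnk-empty j k gt)

  mulX-B≡xBℕ : ∀ k a j → mulX (B k) a j ≡ + xBℕ k a j
  mulX-B≡xBℕ k zero j = refl
  mulX-B≡xBℕ k (suc a) j = B≡Bℕ k a j

  mulT-B≡tOverXBℕ : ∀ k a j → mulT (B k) (suc a) j ≡ + tOverXBℕ k a j
  mulT-B≡tOverXBℕ k a zero = refl
  mulT-B≡tOverXBℕ k a (suc j) = B≡Bℕ k (suc a) j

  mulT-constX-suc : ∀ (E : Ser) a j → mulT (constX E) (suc a) j ≡ + 0
  mulT-constX-suc E a zero = refl
  mulT-constX-suc E a (suc j) = refl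

  kernelEquation : (k : ℕ) → ∀ i j → ((mulX (B k) ⊟₂ mulX (mulX (B k))) ⊟₂ mulT (B k)) i j
      ≡ (mulX (F k) ⊟₂ mulT (constX (D k))) i j
  kernelEquation k zero zero = refl
  kernelEquation k zero (suc j) = cong (λ z → + 0 - + 0 - z) (trans (B≡Bℕ k 0 j) (cong +_ (Bℕ-column0 k j)))
  kernelEquation k (suc a) j = begin
      B k a j - mulX (B k) a j - mulT (B k) (suc a) j
    ≡⟨ cong₂ (λ u v → u - v - mulT (B k) (suc a) j) (B≡Bℕ k a j) (mulX-B≡xBℕ k a j) ⟩
      + Bℕ k a j - + xBℕ k a j - mulT (B k) (suc a) j
    ≡⟨ cong₂ (λ u v → + u - + xBℕ k a j - v) (Bℕ-recurrence k a j) (mulT-B≡tOverXBℕ k a j) ⟩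
      + (xBℕ k a j ℕ.+ (tOverXBℕ k a j ℕ.+ Fℕ k a j)) - + xBℕ k a j - + tOverXBℕ k a j
    ≡⟨ cong (λ u → u - + xBℕ k a j - + tOverXBℕ k a j)
        (trans (pos-+ (xBℕ k a j) _) (cong (λ z → (+ xBℕ k a j) + z) (pos-+ (tOverXBℕ k a j) (Fℕ k a j)))) ⟩
      + xBℕ k a j + (+ tOverXBℕ k a j + + Fℕ k a j) - + xBℕ k a j - + tOverXBℕ k a j
    ≡⟨ cancel (+ xBℕ k a j) (+ tOverXBℕ k a j) (+ Fℕ k a j) ⟩
      + Fℕ k a j - + 0
    ≡⟨ cong₂ _-_ (sym (F≡Fℕ k a j)) (sym (mulT-constX-suc (D k) a j)) ⟩
      F k a j - mulT (constX (D k)) (suc a) j ∎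
    where
    open ≡-Reasoning
    cancel : ∀ (a b c : ℤ) → a + (b + c) - a - b ≡ c - + 0
    cancel = solve-∀

  F≡tDtB : (k : ℕ) → ∀ i j → F (suc k) i j ≡ tDt (B k) i j + (+ 1 - + suc k) * B k i j
  F≡tDtB k i j with NP.≤-<-connex k j
  ... | inj₂ j<k rewrite ≤ᵇ-false j<k | ≤ᵇ-false {suc k} {j} (NP.m<n⇒m<1+n j<k) =
    sym (cong₂ _+_ (ZP.*-zeroʳ (+ j)) (ZP.*-zeroʳ (+ 1 - + suc k)))
  ... | inj₁ k≤j with NP.m≤n⇒m<n∨m≡n k≤j
  ...   | inj₂ refl rewrite ≤ᵇ-true (NP.≤-refl {k}) | ≤ᵇ-false {suc k} {k} NP.≤-refl =
    sym (cancel (+ k) (+ bnmk (i ℕ.+ k) k k))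
    where
    cancel : ∀ (x b : ℤ) → x * b + (+ 1 - (+ 1 + x)) * b ≡ + 0
    cancel = solve-∀
  ...   | inj₁ k<j rewrite ≤ᵇ-true k≤j | ≤ᵇ-true k<j = trans (pos-* (j ∸ k) b)
    (sym (trans (cong₂ (λ u v → u * + b + (+ 1 - v) * + b) j≡k+[j∸k] (pos-+ 1 k)) (collect (+ k) (+ (j ∸ k)) (+ b))))
    where
    b = bnmk (i ℕ.+ j) j k
    j≡k+[j∸k] : + j ≡ + k + + (j ∸ k)
    j≡k+[j∸k] = trans (cong +_ (sym (NP.m+[n∸m]≡n k≤j))) (pos-+ k (j ∸ k))
    collect : ∀ (x d b : ℤ) → (x + d) * b + (+ 1 - (+ 1 + x)) * b ≡ d * b
    collect = solve-∀

module PowerSeries where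

  open import Data.Nat as ℕ using (ℕ; zero; suc; _∸_; _≤_; _<_; z≤n; s≤s)
  import Data.Nat.Properties as NP
  open import Data.Integer using (ℤ; +_; _+_; _-_; _*_; -_)
  import Data.Integer.Properties as ZP
  open import Data.Integer.Tactic.RingSolver using (solve-∀)
  open import Relation.Binary.PropositionalEquality

  sumTo-cong : ∀ N (f g : ℕ → ℤ) → (∀ i → i ≤ N → f i ≡ g i) → sumTo N f ≡ sumTo N g
  sumTo-cong zero f g e = e 0 z≤n
  sumTo-cong (suc N) f g e = cong₂ _+_ (sumTo-cong N f g (λ i h → e i (NP.m≤n⇒m≤1+n h))) (e (suc N) NP.≤-refl)

  sumTo-+ : ∀ N (f g : ℕ → ℤ) → sumTo N (λ i → f i + g i) ≡ sumTo N f + sumTo N g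
  sumTo-+ zero f g = refl
  sumTo-+ (suc N) f g rewrite sumTo-+ N f g = interchange (sumTo N f) (sumTo N g) (f (suc N)) (g (suc N))
    where
    interchange : ∀ a b c d → a + b + (c + d) ≡ a + c + (b + d)
    interchange = solve-∀

  sumTo-- : ∀ N (f g : ℕ → ℤ) → sumTo N (λ i → f i - g i) ≡ sumTo N f - sumTo N g
  sumTo-- zero f g = refl
  sumTo-- (suc N) f g rewrite sumTo-- N f g = interchange (sumTo N f) (sumTo N g) (f (suc N)) (g (suc N))
    where
    interchange : ∀ a b c d → a - b + (c - d) ≡ a + c - (b + d)
    interchange = solve-∀

  sumTo-*l : ∀ N (c : ℤ) (f : ℕ → ℤ) → sumTo N (λ i → c * f i) ≡ c * sumTo N f
  sumTo-*l zero c f = refl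
  sumTo-*l (suc N) c f rewrite sumTo-*l N c f = sym (ZP.*-distribˡ-+ c (sumTo N f) (f (suc N)))

  sumTo-*r : ∀ N (c : ℤ) (f : ℕ → ℤ) → sumTo N (λ i → f i * c) ≡ sumTo N f * c
  sumTo-*r zero c f = refl
  sumTo-*r (suc N) c f rewrite sumTo-*r N c f = sym (ZP.*-distribʳ-+ c (sumTo N f) (f (suc N)))

  sumTo-0 : ∀ N (f : ℕ → ℤ) → (∀ i → i ≤ N → f i ≡ + 0) → sumTo N f ≡ + 0
  sumTo-0 zero f e = e 0 z≤n
  sumTo-0 (suc N) f e rewrite sumTo-0 N f (λ i h → e i (NP.m≤n⇒m≤1+n h)) | e (suc N) NP.≤-refl = refl

  sumTo-shift : ∀ N (f : ℕ → ℤ) → sumTo (suc N) f ≡ f 0 + sumTo N (λ i → f (suc i))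
  sumTo-shift zero f = refl
  sumTo-shift (suc N) f rewrite sumTo-shift N f = ZP.+-assoc (f 0) (sumTo N (λ i → f (suc i))) (f (suc (suc N)))

  sumTo-single0 : ∀ N (f : ℕ → ℤ) → (∀ i → 1 ≤ i → i ≤ N → f i ≡ + 0) → sumTo N f ≡ f 0
  sumTo-single0 zero f e = refl
  sumTo-single0 (suc N) f e rewrite sumTo-single0 N f (λ i a b → e i a (NP.m≤n⇒m≤1+n b)) | e (suc N)
      (s≤s z≤n) NP.≤-refl = ZP.+-identityʳ (f 0)

  sumTo-singleN : ∀ N (f : ℕ → ℤ) → (∀ i → i < N → f i ≡ + 0) → sumTo N f ≡ f N
  sumTo-singleN zero f e = refl
  sumTo-singleN (suc N) f e rewrite sumTo-0 N f (λ i h → e i (s≤s h)) = ZP.+-identityˡ (f (suc N))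

  sumTo-trunc : ∀ K d (f : ℕ → ℤ) → (∀ i → K < i → i ≤ K ℕ.+ d → f i ≡ + 0) → sumTo (K ℕ.+ d) f ≡ sumTo K f
  sumTo-trunc K zero f e rewrite NP.+-identityʳ K = refl
  sumTo-trunc K (suc d) f e rewrite NP.+-suc K d | sumTo-trunc K d f (λ i a b → e i a (NP.m≤n⇒m≤1+n b))
    | e (suc (K ℕ.+ d)) (s≤s (NP.m≤m+n K d)) NP.≤-refl = ZP.+-identityʳ (sumTo K f)

  sumTo-swap : ∀ N M (h : ℕ → ℕ → ℤ) → sumTo N (λ i → sumTo M (λ j → h i j)) ≡ sumTo M (λ j → sumTo N (λ i → h i j))
  sumTo-swap zero M h = refl
  sumTo-swap (suc N) M h rewrite sumTo-swap N M h = sym (sumTo-+ M (λ j → sumTo N (λ i → h i j)) (λ j → h (suc N) j))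

  sumTo-rev : ∀ N (f : ℕ → ℤ) → sumTo N f ≡ sumTo N (λ i → f (N ∸ i))
  sumTo-rev zero f = refl
  sumTo-rev (suc N) f = begin
      sumTo (suc N) f
    ≡⟨ sumTo-shift N f ⟩
      f 0 + sumTo N (λ i → f (suc i))
    ≡⟨ cong (λ z → f 0 + z) (sumTo-rev N (λ i → f (suc i))) ⟩
      f 0 + sumTo N (λ i → f (suc (N ∸ i)))
    ≡⟨ ZP.+-comm (f 0) _ ⟩
      sumTo N (λ i → f (suc (N ∸ i))) + f 0
    ≡⟨ cong₂ _+_ (sumTo-cong N _ _ (λ i h → cong f (sym (NP.+-∸-assoc 1 h)))) (cong f (sym (NP.n∸n≡0 N))) ⟩
      sumTo N (λ i → f (suc N ∸ i)) + f (suc N ∸ suc N) ∎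
    where open ≡-Reasoning

  sumTo-triangle : ∀ N (Fn : ℕ → ℕ → ℤ) → sumTo N (λ i → sumTo i (λ j → Fn i j))
      ≡ sumTo N (λ j → sumTo (N ∸ j) (λ l → Fn (j ℕ.+ l) j))
  sumTo-triangle zero Fn = refl
  sumTo-triangle (suc N) Fn = begin
      sumTo N (λ i → sumTo i (λ j → Fn i j)) + sumTo (suc N) (λ j → Fn (suc N) j)
    ≡⟨ cong (_+ sumTo (suc N) (λ j → Fn (suc N) j)) (sumTo-triangle N Fn) ⟩
      sumTo N (λ j → sumTo (N ∸ j) (λ l → Fn (j ℕ.+ l) j)) + (sumTo N (λ j → Fn (suc N) j) + Fn (suc N) (suc N))
    ≡⟨ sym (ZP.+-assoc (sumTo N (λ j → sumTo (N ∸ j) (λ l → Fn (j ℕ.+ l) j))) (sumTo N (λ j → Fn (suc N) j))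
        (Fn (suc N) (suc N))) ⟩
      sumTo N (λ j → sumTo (N ∸ j) (λ l → Fn (j ℕ.+ l) j)) + sumTo N (λ j → Fn (suc N) j) + Fn (suc N) (suc N)
    ≡⟨ cong₂ _+_ (sym (sumTo-+ N _ _)) (cong (λ z → Fn z (suc N)) (sym (NP.+-identityʳ (suc N)))) ⟩
      sumTo N (λ j → sumTo (N ∸ j) (λ l → Fn (j ℕ.+ l) j) + Fn (suc N) j) + Fn (suc N ℕ.+ 0) (suc N)
    ≡⟨ cong (_+ Fn (suc N ℕ.+ 0) (suc N)) (sumTo-cong N _ _ (λ j h → sym (step j h))) ⟩
      sumTo N (λ j → sumTo (suc N ∸ j) (λ l → Fn (j ℕ.+ l) j)) + Fn (suc N ℕ.+ 0) (suc N)
    ≡⟨ cong (λ z → sumTo N (λ j → sumTo (suc N ∸ j) (λ l → Fn (j ℕ.+ l) j))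
        + sumTo z (λ l → Fn (suc N ℕ.+ l) (suc N))) (sym (NP.n∸n≡0 N)) ⟩
      sumTo (suc N) (λ j → sumTo (suc N ∸ j) (λ l → Fn (j ℕ.+ l) j)) ∎
    where
    open ≡-Reasoning
    step : ∀ j → j ≤ N → sumTo (suc N ∸ j) (λ l → Fn (j ℕ.+ l) j) ≡ sumTo (N ∸ j) (λ l → Fn (j ℕ.+ l) j) + Fn (suc N) j
    step j h rewrite NP.+-∸-assoc 1 h = cong (λ z → sumTo (N ∸ j) (λ l → Fn (j ℕ.+ l) j) + Fn z j)
        (trans (NP.+-suc j (N ∸ j)) (cong suc (NP.m+[n∸m]≡n h)))

  sumTo-triangle-swap : ∀ N (H : ℕ → ℕ → ℤ) → sumTo N (λ i → sumTo (N ∸ i) (λ m → H i m))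
      ≡ sumTo N (λ m → sumTo (N ∸ m) (λ i → H i m))
  sumTo-triangle-swap N H = begin
      sumTo N (λ i → sumTo (N ∸ i) (λ m → H i m))
    ≡⟨ sumTo-cong N _ _ (λ j _ → sumTo-cong (N ∸ j) _ _ (λ l _ → cong (H j) (sym (NP.m+n∸m≡n j l)))) ⟩
      sumTo N (λ j → sumTo (N ∸ j) (λ l → H j ((j ℕ.+ l) ∸ j)))
    ≡⟨ sym (sumTo-triangle N (λ a b → H b (a ∸ b))) ⟩
      sumTo N (λ a → sumTo a (λ b → H b (a ∸ b)))
    ≡⟨ sumTo-cong N _ _ (λ a _ → trans (sumTo-rev a (λ b → H b (a ∸ b)))
        (sumTo-cong a _ _ (λ b h → cong (H (a ∸ b)) (NP.m∸[m∸n]≡n h)))) ⟩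
      sumTo N (λ a → sumTo a (λ b → H (a ∸ b) b))
    ≡⟨ sumTo-triangle N (λ a b → H (a ∸ b) b) ⟩
      sumTo N (λ j → sumTo (N ∸ j) (λ l → H ((j ℕ.+ l) ∸ j) j))
    ≡⟨ sumTo-cong N _ _ (λ j _ → sumTo-cong (N ∸ j) _ _ (λ l _ → cong (λ z → H z j) (NP.m+n∸m≡n j l))) ⟩
      sumTo N (λ m → sumTo (N ∸ m) (λ i → H i m)) ∎
    where open ≡-Reasoning

  ⋆-congˡ : ∀ (f f' h : Ser) → (∀ n → f n ≡ f' n) → ∀ N → (f ⋆ h) N ≡ (f' ⋆ h) N
  ⋆-congˡ f f' h e N = sumTo-cong N _ _ (λ i _ → cong (_* h (N ∸ i)) (e i))

  ⋆-congʳ : ∀ (f h h' : Ser) → (∀ n → h n ≡ h' n) → ∀ N → (f ⋆ h) N ≡ (f ⋆ h') N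
  ⋆-congʳ f h h' e N = sumTo-cong N _ _ (λ i _ → cong (f i *_) (e (N ∸ i)))

  ⋆-assoc : ∀ (f g h : Ser) N → ((f ⋆ g) ⋆ h) N ≡ (f ⋆ (g ⋆ h)) N
  ⋆-assoc f g h N = begin
      sumTo N (λ i → sumTo i (λ j → f j * g (i ∸ j)) * h (N ∸ i))
    ≡⟨ sumTo-cong N _ _ (λ i _ → sym (sumTo-*r i (h (N ∸ i)) (λ j → f j * g (i ∸ j)))) ⟩
      sumTo N (λ i → sumTo i (λ j → f j * g (i ∸ j) * h (N ∸ i)))
    ≡⟨ sumTo-triangle N (λ i j → f j * g (i ∸ j) * h (N ∸ i)) ⟩
      sumTo N (λ j → sumTo (N ∸ j) (λ l → f j * g ((j ℕ.+ l) ∸ j) * h (N ∸ (j ℕ.+ l))))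
    ≡⟨ sumTo-cong N _ _ (λ j _ → trans
        (sumTo-cong (N ∸ j) _ _ (λ l _ → trans
        (cong₂ (λ u v → f j * g u * h v) (NP.m+n∸m≡n j l) (sym (NP.∸-+-assoc N j l)))
        (ZP.*-assoc (f j) (g l) (h (N ∸ j ∸ l)))))
         (sumTo-*l (N ∸ j) (f j) (λ l → g l * h (N ∸ j ∸ l)))) ⟩
      sumTo N (λ j → f j * sumTo (N ∸ j) (λ l → g l * h (N ∸ j ∸ l))) ∎
    where open ≡-Reasoning

  ⋆-distribʳ-⊟ : ∀ (f g h : Ser) N → ((f ⊟ g) ⋆ h) N ≡ (f ⋆ h) N - (g ⋆ h) N
  ⋆-distribʳ-⊟ f g h N = trans (sumTo-cong N _ _ (λ i _ → *-distribʳ-- (f i) (g i) (h (N ∸ i)))) (sumTo-- N _ _)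
    where
    *-distribʳ-- : ∀ a b c → (a - b) * c ≡ a * c - b * c
    *-distribʳ-- = solve-∀

  oneS-⋆ : ∀ (f : Ser) N → (oneS ⋆ f) N ≡ f N
  oneS-⋆ f N = trans (sumTo-single0 N _ (λ { (suc i) _ _ → refl })) (ZP.*-identityˡ (f N))

  ⋆-oneS : ∀ (f : Ser) N → (f ⋆ oneS) N ≡ f N
  ⋆-oneS f N = trans (sumTo-singleN N _ (λ i i<N → trans (cong (λ z → f i * oneS z) (NP.+-∸-assoc 1 i<N))
      (ZP.*-zeroʳ (f i))))
    (trans (cong (λ z → f N * oneS z) (NP.n∸n≡0 N)) (ZP.*-identityʳ (f N)))

  mulTS-oneS-⋆ : ∀ (f : Ser) N → (mulTS oneS ⋆ f) N ≡ mulTS f N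
  mulTS-oneS-⋆ f zero = refl
  mulTS-oneS-⋆ f (suc N) = trans (sumTo-shift N _) (trans (ZP.+-identityˡ _) (oneS-⋆ f N))

  oneMinus4t≡1-4t : ∀ n → oneMinus4t n ≡ oneS n - + 4 * mulTS oneS n
  oneMinus4t≡1-4t zero = refl
  oneMinus4t≡1-4t (suc zero) = refl
  oneMinus4t≡1-4t (suc (suc n)) = refl

  module Substitution (X : Ser) (X0≡0 : X 0 ≡ + 0) where

    powX : ℕ → Ser
    powX = powS X

    powX-vanish : ∀ a L → L < a → powX a L ≡ + 0
    powX-vanish (suc a) L L<a = sumTo-0 L _ vanish
      where
      vanish : ∀ i → i ≤ L → X i * powX a (L ∸ i) ≡ + 0
      vanish zero _ rewrite X0≡0 = refl
      vanish (suc i) i≤L = trans (cong (X (suc i) *_)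
          (powX-vanish a (L ∸ suc i) (NP.<-≤-trans (NP.∸-monoʳ-< (s≤s z≤n) i≤L) (NP.≤-pred L<a))))
          (ZP.*-zeroʳ (X (suc i)))

    -- [t^L] of Σ_a G_{a,m} X^a; the sum over a may stop at L because X^a = O(t^a).
    columnAt : Ser2 → ℕ → ℕ → ℤ
    columnAt G m L = sumTo L (λ a → G a m * powX a L)

    columnAt-extend : ∀ (G : Ser2) m L d → sumTo (L ℕ.+ d) (λ a → G a m * powX a L) ≡ columnAt G m L
    columnAt-extend G m L d = sumTo-trunc L d _
        (λ a L<a _ → trans (cong (G a m *_) (powX-vanish a L L<a)) (ZP.*-zeroʳ (G a m)))

    substX≡sumTo-columnAt : ∀ (G : Ser2) N → substX G X N ≡ sumTo N (λ m → columnAt G m (N ∸ m))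
    substX≡sumTo-columnAt G N = sumTo-cong N _ _
        (λ m m≤N → trans (cong (λ z → sumTo z (λ a → G a m * powX a (N ∸ m))) (sym (NP.m∸n+n≡m m≤N)))
        (columnAt-extend G m (N ∸ m) m))

    columnAt-mulX : ∀ (G : Ser2) m L → columnAt (mulX G) m L ≡ sumTo L (λ a → G a m * (X ⋆ powX a) L)
    columnAt-mulX G m zero rewrite X0≡0 = sym (ZP.*-zeroʳ (G 0 m))
    columnAt-mulX G m (suc L) = begin
        columnAt (mulX G) m (suc L)
      ≡⟨ sumTo-shift L _ ⟩
        + 0 * powX 0 (suc L) + sumTo L (λ a → G a m * powX (suc a) (suc L))
      ≡⟨ ZP.+-identityˡ _ ⟩
        sumTo L (λ a → G a m * powX (suc a) (suc L))
      ≡⟨ sym (ZP.+-identityʳ _) ⟩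
        sumTo L (λ a → G a m * powX (suc a) (suc L)) + + 0
      ≡⟨ cong (λ z → sumTo L (λ a → G a m * powX (suc a) (suc L)) + z)
          (sym (trans (cong (G (suc L) m *_) (powX-vanish (suc (suc L)) (suc L) NP.≤-refl))
          (ZP.*-zeroʳ (G (suc L) m)))) ⟩
        sumTo (suc L) (λ a → G a m * (X ⋆ powX a) (suc L)) ∎
      where open ≡-Reasoning

    substX-mulX : ∀ (G : Ser2) N → substX (mulX G) X N ≡ (X ⋆ substX G X) N
    substX-mulX G N = begin
        substX (mulX G) X N
      ≡⟨ substX≡sumTo-columnAt (mulX G) N ⟩
        sumTo N (λ m → columnAt (mulX G) m (N ∸ m))
      ≡⟨ sumTo-cong N _ _ (λ m m≤N → trans (columnAt-mulX G m (N ∸ m)) (factorX m)) ⟩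
        sumTo N (λ m → sumTo (N ∸ m) (λ i → X i * columnAt G m (N ∸ i ∸ m)))
      ≡⟨ sym (sumTo-triangle-swap N (λ i m → X i * columnAt G m (N ∸ i ∸ m))) ⟩
        sumTo N (λ i → sumTo (N ∸ i) (λ m → X i * columnAt G m (N ∸ i ∸ m)))
      ≡⟨ sumTo-cong N _ _ (λ i _ → trans (sumTo-*l (N ∸ i) (X i) _)
          (cong (X i *_) (sym (substX≡sumTo-columnAt G (N ∸ i))))) ⟩
        (X ⋆ substX G X) N ∎
      where
      open ≡-Reasoning
      factorX : ∀ m → sumTo (N ∸ m) (λ a → G a m * (X ⋆ powX a) (N ∸ m))
          ≡ sumTo (N ∸ m) (λ i → X i * columnAt G m (N ∸ i ∸ m))
      factorX m = begin
          sumTo L (λ a → G a m * sumTo L (λ i → X i * powX a (L ∸ i)))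
        ≡⟨ sumTo-cong L _ _ (λ a _ → trans (sym (sumTo-*l L (G a m) _))
            (sumTo-cong L _ _ (λ i _ → left-comm (G a m) (X i) (powX a (L ∸ i))))) ⟩
          sumTo L (λ a → sumTo L (λ i → X i * (G a m * powX a (L ∸ i))))
        ≡⟨ sumTo-swap L L _ ⟩
          sumTo L (λ i → sumTo L (λ a → X i * (G a m * powX a (L ∸ i))))
        ≡⟨ sumTo-cong L _ _ (λ i i≤L → trans (sumTo-*l L (X i) _)
            (cong (X i *_) (trans (cong (λ z → sumTo z (λ a → G a m * powX a (L ∸ i))) (sym (NP.m∸n+n≡m i≤L)))
            (trans (columnAt-extend G m (L ∸ i) i) (cong (columnAt G m) (∸-swap N m i)))))) ⟩
          sumTo L (λ i → X i * columnAt G m (N ∸ i ∸ m)) ∎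
        where
        L = N ∸ m
        left-comm : ∀ g x p → g * (x * p) ≡ x * (g * p)
        left-comm = solve-∀
        ∸-swap : ∀ N m i → N ∸ m ∸ i ≡ N ∸ i ∸ m
        ∸-swap N m i = trans (NP.∸-+-assoc N m i) (trans (cong (N ∸_) (NP.+-comm m i)) (sym (NP.∸-+-assoc N i m)))

    substX-mulT : ∀ (G : Ser2) N → substX (mulT G) X N ≡ mulTS (substX G X) N
    substX-mulT G zero = refl
    substX-mulT G (suc N) = begin
        substX (mulT G) X (suc N)
      ≡⟨ substX≡sumTo-columnAt (mulT G) (suc N) ⟩
        sumTo (suc N) (λ m → columnAt (mulT G) m (suc N ∸ m))
      ≡⟨ sumTo-shift N _ ⟩
        columnAt (mulT G) 0 (suc N) + sumTo N (λ m → columnAt G m (N ∸ m))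
      ≡⟨ cong (_+ sumTo N (λ m → columnAt G m (N ∸ m))) (sumTo-0 (suc N) _ (λ a _ → refl)) ⟩
        + 0 + sumTo N (λ m → columnAt G m (N ∸ m))
      ≡⟨ ZP.+-identityˡ _ ⟩
        sumTo N (λ m → columnAt G m (N ∸ m))
      ≡⟨ sym (substX≡sumTo-columnAt G N) ⟩
        substX G X N ∎
      where open ≡-Reasoning

    substX-constX : ∀ (E : Ser) N → substX (constX E) X N ≡ E N
    substX-constX E N = begin
        substX (constX E) X N
      ≡⟨ substX≡sumTo-columnAt (constX E) N ⟩
        sumTo N (λ m → columnAt (constX E) m (N ∸ m))
      ≡⟨ sumTo-cong N _ _ (λ m _ → sumTo-single0 (N ∸ m) _ (λ { (suc a) _ _ → refl })) ⟩
        (E ⋆ oneS) N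
      ≡⟨ ⋆-oneS E N ⟩
        E N ∎
      where open ≡-Reasoning

    substX-⊟ : ∀ (G H : Ser2) N → substX (G ⊟₂ H) X N ≡ substX G X N - substX H X N
    substX-⊟ G H N = trans (sumTo-cong N _ _ (λ m _ → trans
        (sumTo-cong N _ _ (λ a _ → *-distribʳ-- (G a m) (H a m) (powX a (N ∸ m)))) (sumTo-- N _ _)))
        (sumTo-- N _ _)
      where
      *-distribʳ-- : ∀ a b c → (a - b) * c ≡ a * c - b * c
      *-distribʳ-- = solve-∀

    substX-cong : ∀ (G H : Ser2) → (∀ i j → G i j ≡ H i j) → ∀ N → substX G X N ≡ substX H X N
    substX-cong G H e N = sumTo-cong N _ _ (λ m _ → sumTo-cong N _ _ (λ a _ → cong (_* powX a (N ∸ m)) (e a m)))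

    substX-F0 : ∀ N → substX (F 0) X N ≡ oneS N
    substX-F0 N = trans (substX-cong (F 0) (constX oneS) F0≡1 N) (substX-constX oneS N)
      where
      F0≡1 : ∀ i j → F 0 i j ≡ constX oneS i j
      F0≡1 zero zero = refl
      F0≡1 zero (suc j) = refl
      F0≡1 (suc i) j = refl

    -- Kernel method: the left side is (x - x² - t) G, which the substitution x := X annihilates.
    kernel-method : (∀ n → (X ⊟ (X ⋆ X)) n ≡ mulTS oneS n) → ∀ (G Fk : Ser2) (E : Ser) →
        (∀ i j → ((mulX G ⊟₂ mulX (mulX G)) ⊟₂ mulT G) i j ≡ (mulX Fk ⊟₂ mulT (constX E)) i j) →
      ∀ N → mulTS E N ≡ (X ⋆ substX Fk X) N
    kernel-method X-X²≡t G Fk E kernel N = ≡-from-difference (trans (sym rhs) lhs)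
      where
      sG = substX G X
      lhs : substX ((mulX G ⊟₂ mulX (mulX G)) ⊟₂ mulT G) X N ≡ + 0
      lhs = begin
          substX ((mulX G ⊟₂ mulX (mulX G)) ⊟₂ mulT G) X N
        ≡⟨ substX-⊟ (mulX G ⊟₂ mulX (mulX G)) (mulT G) N ⟩
          substX (mulX G ⊟₂ mulX (mulX G)) X N - substX (mulT G) X N
        ≡⟨ cong₂ _-_ (substX-⊟ (mulX G) (mulX (mulX G)) N) (substX-mulT G N) ⟩
          substX (mulX G) X N - substX (mulX (mulX G)) X N - mulTS sG N
        ≡⟨ cong₂ (λ u v → u - v - mulTS sG N) (substX-mulX G N)
            (trans (substX-mulX (mulX G) N) (⋆-congʳ X _ _ (substX-mulX G) N)) ⟩
          (X ⋆ sG) N - (X ⋆ (X ⋆ sG)) N - mulTS sG N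
        ≡⟨ cong (λ z → (X ⋆ sG) N - z - mulTS sG N) (sym (⋆-assoc X X sG N)) ⟩
          (X ⋆ sG) N - ((X ⋆ X) ⋆ sG) N - mulTS sG N
        ≡⟨ cong (_- mulTS sG N) (sym (⋆-distribʳ-⊟ X (X ⋆ X) sG N)) ⟩
          ((X ⊟ (X ⋆ X)) ⋆ sG) N - mulTS sG N
        ≡⟨ cong (_- mulTS sG N) (trans (⋆-congˡ _ _ sG X-X²≡t N) (mulTS-oneS-⋆ sG N)) ⟩
          mulTS sG N - mulTS sG N
        ≡⟨ ZP.+-inverseʳ (mulTS sG N) ⟩
          + 0 ∎
        where open ≡-Reasoning
      mulTS-substX-constX : ∀ N → mulTS (substX (constX E) X) N ≡ mulTS E N
      mulTS-substX-constX zero = refl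
      mulTS-substX-constX (suc N) = substX-constX E N
      rhs : substX ((mulX G ⊟₂ mulX (mulX G)) ⊟₂ mulT G) X N ≡ (X ⋆ substX Fk X) N - mulTS E N
      rhs = begin
          substX ((mulX G ⊟₂ mulX (mulX G)) ⊟₂ mulT G) X N
        ≡⟨ substX-cong _ _ kernel N ⟩
          substX (mulX Fk ⊟₂ mulT (constX E)) X N
        ≡⟨ substX-⊟ (mulX Fk) (mulT (constX E)) N ⟩
          substX (mulX Fk) X N - substX (mulT (constX E)) X N
        ≡⟨ cong₂ _-_ (substX-mulX Fk N) (trans (substX-mulT (constX E) N) (mulTS-substX-constX N)) ⟩
          (X ⋆ substX Fk X) N - mulTS E N ∎
        where open ≡-Reasoning
      ≡-from-difference : ∀ {e y} → y - e ≡ + 0 → e ≡ y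
      ≡-from-difference {e} {y} y-e≡0 = sym (trans (sym (ZP.+-identityʳ y))
          (trans (cong (λ z → y + z) (sym (ZP.+-inverseˡ e))) (trans (sym (ZP.+-assoc y (- e) e))
          (trans (cong (_+ e) y-e≡0) (ZP.+-identityˡ e)))))

  -- Sq stands for √(1 - 4t), so X = (1 - √(1 - 4t))/2.
  module CatalanRoot (Sq X : Ser) (Sq0≡1 : Sq 0 ≡ + 1) (Sq²≡1-4t : ∀ n → (Sq ⋆ Sq) n ≡ oneMinus4t n)
      (2X≡1-Sq : ∀ n → + 2 * X n ≡ (oneS ⊟ Sq) n) where

    X0≡0 : X 0 ≡ + 0
    X0≡0 = ZP.*-cancelˡ-≡ (+ 2) (X 0) (+ 0) (trans (2X≡1-Sq 0) (cong (λ z → + 1 - z) Sq0≡1))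

    Sq≡1-2X : ∀ n → Sq n ≡ oneS n - + 2 * X n
    Sq≡1-2X n = trans (double-negation (oneS n) (Sq n)) (cong (λ z → oneS n - z) (sym (2X≡1-Sq n)))
      where
      double-negation : ∀ o s → s ≡ o - (o - s)
      double-negation = solve-∀

    Sq⋆Sq≡1-4X+4X⋆X : ∀ n → oneS n - + 2 * X n - + 2 * X n + + 4 * (X ⋆ X) n ≡ (Sq ⋆ Sq) n
    Sq⋆Sq≡1-4X+4X⋆X n = begin
        oneS n - + 2 * X n - + 2 * X n + + 4 * (X ⋆ X) n
      ≡⟨ cong₂ (λ u v → oneS n - + 2 * u - + 2 * v + + 4 * (X ⋆ X) n) (sym (oneS-⋆ X n)) (sym (⋆-oneS X n)) ⟩
        oneS n - + 2 * (oneS ⋆ X) n - + 2 * (X ⋆ oneS) n + + 4 * (X ⋆ X) n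
      ≡⟨ cong (λ u → u - + 2 * (oneS ⋆ X) n - + 2 * (X ⋆ oneS) n + + 4 * (X ⋆ X) n) (sym (oneS-⋆ oneS n)) ⟩
        (oneS ⋆ oneS) n - + 2 * (oneS ⋆ X) n - + 2 * (X ⋆ oneS) n + + 4 * (X ⋆ X) n
      ≡⟨ cong₂ (λ u v → (oneS ⋆ oneS) n - u - v + + 4 * (X ⋆ X) n) (sym (sumTo-*l n (+ 2) _)) (sym (sumTo-*l n (+ 2) _)) ⟩
        (oneS ⋆ oneS) n - sumTo n (λ i → + 2 * (oneS i * X (n ∸ i))) - sumTo n (λ i → + 2 * (X i * oneS (n ∸ i))) +
            + 4 * (X ⋆ X) n
      ≡⟨ cong (λ u → (oneS ⋆ oneS) n - sumTo n (λ i → + 2 * (oneS i * X (n ∸ i)))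
          - sumTo n (λ i → + 2 * (X i * oneS (n ∸ i))) + u) (sym (sumTo-*l n (+ 4) _)) ⟩
        (oneS ⋆ oneS) n - sumTo n (λ i → + 2 * (oneS i * X (n ∸ i))) - sumTo n (λ i → + 2 * (X i * oneS (n ∸ i)))
            + sumTo n (λ i → + 4 * (X i * X (n ∸ i)))
      ≡⟨ cong (λ u → u - sumTo n (λ i → + 2 * (X i * oneS (n ∸ i))) + sumTo n (λ i → + 4 * (X i * X (n ∸ i))))
          (sym (sumTo-- n _ _)) ⟩
        sumTo n (λ i → oneS i * oneS (n ∸ i) - + 2 * (oneS i * X (n ∸ i))) - sumTo n (λ i → + 2 * (X i * oneS (n ∸ i)))
            + sumTo n (λ i → + 4 * (X i * X (n ∸ i)))
      ≡⟨ cong (λ u → u + sumTo n (λ i → + 4 * (X i * X (n ∸ i)))) (sym (sumTo-- n _ _)) ⟩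
        sumTo n (λ i → oneS i * oneS (n ∸ i) - + 2 * (oneS i * X (n ∸ i)) - + 2 * (X i * oneS (n ∸ i)))
            + sumTo n (λ i → + 4 * (X i * X (n ∸ i)))
      ≡⟨ sym (sumTo-+ n _ _) ⟩
        sumTo n (λ i → oneS i * oneS (n ∸ i) - + 2 * (oneS i * X (n ∸ i)) - + 2 * (X i * oneS (n ∸ i)) + + 4 * (X i * X (n ∸ i)))
      ≡⟨ sumTo-cong n _ _ (λ i _ → trans (sym (expand-product (oneS i) (X i) (oneS (n ∸ i)) (X (n ∸ i))))
          (sym (cong₂ _*_ (Sq≡1-2X i) (Sq≡1-2X (n ∸ i))))) ⟩
        (Sq ⋆ Sq) n ∎
      where
      open ≡-Reasoning
      expand-product : ∀ a b c d → (a - + 2 * b) * (c - + 2 * d) ≡ a * c - + 2 * (a * d) - + 2 * (b * c) + + 4 * (b * d)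
      expand-product = solve-∀

    X-X²≡t : ∀ n → (X ⊟ (X ⋆ X)) n ≡ mulTS oneS n
    X-X²≡t n = ZP.*-cancelˡ-≡ (+ 4) _ _ (cancel (oneS n) (X n) ((X ⋆ X) n) (mulTS oneS n)
        (trans (Sq⋆Sq≡1-4X+4X⋆X n) (trans (Sq²≡1-4t n) (oneMinus4t≡1-4t n))))
      where
      cancel : ∀ o x y t → o - + 2 * x - + 2 * x + + 4 * y ≡ o - + 4 * t → + 4 * (x - y) ≡ + 4 * t
      cancel o x y t e = trans (rearrange o x y t) (trans (cong (λ z → (o - + 4 * t) - z + + 4 * t) e) (collapse o t))
        where
        rearrange : ∀ o x y t → + 4 * (x - y) ≡ (o - + 4 * t) - (o - + 2 * x - + 2 * x + + 4 * y) + + 4 * t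
        rearrange = solve-∀
        collapse : ∀ o t → (o - + 4 * t) - (o - + 4 * t) + + 4 * t ≡ + 4 * t
        collapse = solve-∀

open Tableaux
open Coefficients
open PowerSeries

open import Data.Nat using (ℕ; zero; suc)
open import Data.Integer using (ℤ; +_; _+_; _-_; _*_)
open import Data.Product using (_×_; _,_)
open import Relation.Binary.PropositionalEquality using (_≡_; trans)

theorem3p2 : (Sq X2 : Ser)
    → Sq 0 ≡ + 1
    → (∀ n → (Sq ⋆ Sq) n ≡ oneMinus4t n)
    → (∀ n → + 2 * X2 n ≡ (oneS ⊟ Sq) n)
    → ((k : ℕ)
    → (∀ n → mulTS (D (suc k)) n ≡ (X2 ⋆ substX (F (suc k)) X2) n)
    × (∀ i j → F (suc k) i j ≡ tDt (B k) i j + (+ 1 - + suc k) * B k i j))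
    × ((k : ℕ) → ∀ i j
    → ((mulX (B k) ⊟₂ mulX (mulX (B k))) ⊟₂ mulT (B k)) i j
    ≡ (mulX (F k) ⊟₂ mulT (constX (D k))) i j)
    × (∀ n → mulTS (D 0) n ≡ X2 n)
theorem3p2 Sq X2 Sq0≡1 Sq²≡1-4t 2X≡1-Sq =
  (λ k → kernel (suc k) , F≡tDtB k) , kernelEquation , tD₀≡X2
  where
  open CatalanRoot Sq X2 Sq0≡1 Sq²≡1-4t 2X≡1-Sq
  open Substitution X2 X0≡0
  kernel : ∀ k n → mulTS (D k) n ≡ (X2 ⋆ substX (F k) X2) n
  kernel k = kernel-method X-X²≡t (B k) (F k) (D k) (kernelEquation k)
  tD₀≡X2 : ∀ n → mulTS (D 0) n ≡ X2 n
  tD₀≡X2 n = trans (kernel 0 n) (trans (⋆-congʳ X2 (substX (F 0) X2) oneS substX-F0 n) (⋆-oneS X2 n))
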